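{- Let $P$ be any policy with $P_{\textsc{mid}}(p)[i]\ge 1$ for all policy states $p\in\Pi$ and each $i\in\{0,1\}$. Then the problem "given a game DFA $D$ (encoded as its transition table, start state and final-state sets, of size $\Theta(|Q|)$), does the existential team have a forced win in the Team DFA Game with Communication on $(D,P)$?" is decidable in PSPACE.
   Context: Team DFA Game with Communication (TDGC). An instance is a pair $(D,P)$. $D=(\{0,1\},Q,q_0,\delta,F_\exists\cup F_\forall)$ is a DFA over the binary alphabet with disjoint sets $F_\exists,F_\forall\subseteq Q$ of final states. A policy $P$ consists of a DFA over a unary alphabet with finite state set $\Pi$, start state $p_0$ and transition function $\pi:\Pi\to\Pi$, together with functions $P_{\textsc{mid}},P_{\textsc{end}}:\Pi\to\mathbb{N}\times\mathbb{N}$; for a pair $v$, $v[0],v[1]$ denote its components. The existential team $\{\exists_0,\exists_1\}$ plays against the universal player $\forall$. The game starts with $D$ in $q_0$ and the policy in $p_0$; each round, with $D$ in state $q$ and the policy in state $p$, proceeds as follows: (1) if $q\in F_\exists$ the existential team wins; if $q\in F_\forall$ the universal team wins. (2) $\forall$ learns $q$ and chooses bits $b_0,b_1$, which are input to $D$ in that order. (3) $\exists_0$ learns $b_0$ and $\exists_1$ learns $b_1$. (4) Mid-round exchange: $\exists_0$ privately chooses a message of $P_{\textsc{mid}}(p)[0]$ bits and $\exists_1$ privately chooses a message of $P_{\textsc{mid}}(p)[1]$ bits; then $\exists_1$ and $\forall$ learn $\exists_0$'s message and $\exists_0$ and $\forall$ learn $\exists_1$'s message. (5) $\exists_0$ inputs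 a bit $m_0$ into $D$, then $\exists_1$ inputs a bit $m_1$ into $D$ (neither $\exists$ player sees the other's bit); $\forall$ learns $m_0$ and $m_1$. (6) End-round exchange: the same as step (4) but with $P_{\textsc{end}}(p)$ in place of $P_{\textsc{mid}}(p)$. (7) The policy state becomes $\pi(p)$. Each player's strategy chooses its next action as a function of all information that player has learned so far. The existential team has a forced win if there exist strategies for $\exists_0$ and $\exists_1$ such that, against every strategy of $\forall$, the game eventually reaches a round in which $D$'s state is in $F_\exists$. -}

module Defs where

open import Data.Bool using (Bool; true; false)
open import Data.Nat using (ℕ; zero; suc; _+_; _*_; _^_; _≤_; _<_)
open import Data.Fin using (Fin; toℕ) renaming (zero to fzero; suc to fsuc)
open import Data.List using (List; []; _∷_; _++_; length; map; concatMap; allFin)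
open import Data.Vec using (Vec; toList)
open import Data.Product using (Σ; _×_; _,_; proj₁; proj₂; ∃)
open import Data.Sum using (_⊎_; inj₁; inj₂)
open import Function.Bundles using (_⇔_)
open import Relation.Binary.PropositionalEquality using (_≡_)

-- Game DFAs over the binary alphabet {0,1} = Bool (false = 0, true = 1)
-- Q = Fin nQ, final sets given by their characteristic functions.

record GameDFA : Set where
  field
    nQ       : ℕ
    q₀       : Fin nQ
    δ        : Fin nQ → Bool → Fin nQ
    F∃       : Fin nQ → Bool
    F∀       : Fin nQ → Bool
    disjoint : (q : Fin nQ) → F∃ q ≡ true → F∀ q ≡ false

-- Policies: unary DFA with state set Π = Fin size, start p₀, transition π,
-- and P_mid, P_end : Π → ℕ × ℕ.

record Policy : Set where
  field
    size : ℕ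
    p₀   : Fin size
    π    : Fin size → Fin size
    Pmid : Fin size → ℕ × ℕ
    Pend : Fin size → ℕ × ℕ

_⟨_⟩ : ℕ × ℕ → Fin 2 → ℕ
v ⟨ fzero ⟩ = proj₁ v
v ⟨ fsuc _ ⟩ = proj₂ v

iter : {A : Set} → (A → A) → ℕ → A → A
iter f zero    a = a
iter f (suc n) a = f (iter f n a)

-- policy state at the start of round r (rounds numbered from 0)
pstate : (P : Policy) → ℕ → Fin (Policy.size P)
pstate P r = iter (Policy.π P) r (Policy.p₀ P)

-- Everything that happens in one round:
-- ∀'s bits b0 b1, mid-round messages x0 x1, ∃'s bits m0 m1,
-- end-round messages y0 y1.

record Round : Set where
  constructor round
  field
    b0 b1 : Bool
    x0 x1 : List Bool
    m0 m1 : Bool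
    y0 y1 : List Bool

-- What ∃ᵢ learns in one round: its own bit bᵢ, both mid messages,
-- its own bit mᵢ, both end messages.
record View : Set where
  constructor view
  field
    b     : Bool
    x0 x1 : List Bool
    m     : Bool
    y0 y1 : List Bool

viewOf : Fin 2 → Round → View
viewOf fzero    (round b0 b1 x0 x1 m0 m1 y0 y1) = view b0 x0 x1 m0 y0 y1
viewOf (fsuc _) (round b0 b1 x0 x1 m0 m1 y0 y1) = view b1 x0 x1 m1 y0 y1

-- Histories are lists of rounds, most recent round first.
-- Strategy of ∃ᵢ: its actions are functions of everything it has learned.
record ExStrategy (P : Policy) (i : Fin 2) : Set where
  field
    midMsg  : (h : List View) (b : Bool) →
              Vec Bool (Policy.Pmid P (pstate P (length h)) ⟨ i ⟩)
    moveBit : (h : List View) (b : Bool) (x0 x1 : List Bool) → Bool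
    endMsg  : (h : List View) (b : Bool) (x0 x1 : List Bool) (m : Bool) →
              Vec Bool (Policy.Pend P (pstate P (length h)) ⟨ i ⟩)

-- ∀ learns everything (the DFA state is determined by the history),
-- so its strategy chooses (b0 , b1) as a function of the full history.
UniStrategy : Set
UniStrategy = List Round → Bool × Bool

module Play (P : Policy) (s₀ : ExStrategy P fzero) (s₁ : ExStrategy P (fsuc fzero))
            (σ : UniStrategy) where
  open ExStrategy

  nextRound : List Round → Round
  nextRound h =
    let bs = σ h
        b0 = proj₁ bs
        b1 = proj₂ bs
        v0 = map (viewOf fzero) h
        v1 = map (viewOf (fsuc fzero)) h
        x0 = toList (midMsg s₀ v0 b0)
        x1 = toList (midMsg s₁ v1 b1)
        m0 = moveBit s₀ v0 b0 x0 x1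
        m1 = moveBit s₁ v1 b1 x0 x1
        y0 = toList (endMsg s₀ v0 b0 x0 x1 m0)
        y1 = toList (endMsg s₁ v1 b1 x0 x1 m1)
    in round b0 b1 x0 x1 m0 m1 y0 y1

  hist : ℕ → List Round
  hist zero    = []
  hist (suc r) = nextRound (hist r) ∷ hist r

dfaState : (D : GameDFA) → List Round → Fin (GameDFA.nQ D)
dfaState D []      = GameDFA.q₀ D
dfaState D (round b0 b1 _ _ m0 m1 _ _ ∷ h) =
  let δ = GameDFA.δ D in δ (δ (δ (δ (dfaState D h) b0) b1) m0) m1

ForcedWin : GameDFA → Policy → Set
ForcedWin D P =
  Σ (ExStrategy P fzero) λ s₀ →
  Σ (ExStrategy P (fsuc fzero)) λ s₁ →
  (σ : UniStrategy) →
  let q = λ r → dfaState D (Play.hist P s₀ s₁ σ r) in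
  Σ ℕ λ r → (GameDFA.F∃ D (q r) ≡ true) ×
            ((r' : ℕ) → r' < r → GameDFA.F∀ D (q r') ≡ false)

unary : ℕ → List Bool
unary zero    = false ∷ []
unary (suc k) = true ∷ unary k

encode : GameDFA → List Bool
encode D =
  unary nQ ++ unary (toℕ q₀) ++
  concatMap (λ q → unary (toℕ (δ q false)) ++ unary (toℕ (δ q true))
                   ++ (F∃ q ∷ F∀ q ∷ [])) (allFin nQ)
  where open GameDFA D

-- Deterministic single-tape Turing machines (two-way infinite tape).
-- Tape alphabet Fin (3 + k): 0 = blank, 1 = bit 0, 2 = bit 1, others extra.

data Move : Set where
  moveL moveR stay : Move

record TM : Set where
  field
    nStates : ℕ
    nExtra  : ℕ
    start   : Fin nStates
    trans   : Fin nStates → Fin (3 + nExtra) →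
              (Fin nStates × Fin (3 + nExtra) × Move) ⊎ Bool

module Machine (M : TM) where
  open TM M

  Γ : Set
  Γ = Fin (3 + nExtra)

  blank : Γ
  blank = fzero

  sym : Bool → Γ
  sym false = fsuc fzero
  sym true  = fsuc (fsuc fzero)

  record Config : Set where
    constructor cfg
    field
      state : Fin nStates
      left  : List Γ   -- cells left of the head, nearest first
      head  : Γ
      right : List Γ   -- cells right of the head, nearest first

  -- number of tape cells visited so far
  space : Config → ℕ
  space (cfg _ l _ r) = suc (length l + length r)

  shift : Move → List Γ → Γ → List Γ → (List Γ × Γ × List Γ)
  shift moveL []      a r       = [] , blank , a ∷ r
  shift moveL (c ∷ l) a r       = l , c , a ∷ r
  shift moveR l       a []      = a ∷ l , blank , []
  shift moveR l       a (c ∷ r) = a ∷ l , c , r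
  shift stay  l       a r       = l , a , r

  step : Config → Config ⊎ Bool
  step (cfg s l a r) with trans s a
  ... | inj₂ b = inj₂ b
  ... | inj₁ (s' , a' , d) with shift d l a' r
  ...   | (l' , a'' , r') = inj₁ (cfg s' l' a'' r')

  run : ℕ → Config → Config ⊎ Bool
  run zero    c = inj₁ c
  run (suc t) c with step c
  ... | inj₁ c' = run t c'
  ... | inj₂ b  = inj₂ b

  init : List Bool → Config
  init []      = cfg start [] blank []
  init (x ∷ w) = cfg start [] (sym x) (map sym w)

  HaltsWithinSpace : List Bool → ℕ → Set
  HaltsWithinSpace w s =
    (∃ λ t → ∃ λ b → run t (init w) ≡ inj₂ b) ×
    ((t : ℕ) (c : Config) → run t (init w) ≡ inj₁ c → space c ≤ s)

  Accepts : List Bool → Set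
  Accepts w = ∃ λ t → run t (init w) ≡ inj₂ true

DecidableInPSPACE : {A : Set} → (A → List Bool) → (A → Set) → Set
DecidableInPSPACE {A} enc L =
  Σ TM λ M → Σ ℕ λ c → Σ ℕ λ k →
    ((w : List Bool) → Machine.HaltsWithinSpace M w (c * suc (length w) ^ k)) ×
    ((a : A) → Machine.Accepts M (enc a) ⇔ L a)

MidPositive : Policy → Set
MidPositive P = (p : Fin (Policy.size P)) →
  (1 ≤ proj₁ (Policy.Pmid P p)) × (1 ≤ proj₂ (Policy.Pmid P p))

-- Each mid-round message has at least one bit, so every ∃ player can forward its
-- bit from ∀ to its partner: both know the whole play, and the game becomes one of
-- perfect information whose rounds consist of two bits chosen by ∀ and two chosen
-- by ∃.  Its winning region is the least fixpoint of one-step attraction on four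
-- marks per state.  ∃ wins from a marked start by descending through the iterates,
-- four levels per round; ∀ wins from an unmarked start by never entering the
-- stable marks.  A single-tape machine computes the fixpoint in place on the
-- encoding of D: the marks of the states are broadcast one after another while
-- every unary successor pointer counts down, so each iteration is a sequence of
-- sweeps that never leaves the |w| + 2 cells around the input.
module Submission where

open import Data.Bool using (Bool; true; false; not; _∧_; _∨_; if_then_else_)
open import Data.Bool.Properties using (∨-conicalʳ; ∨-conicalˡ; ∨-identityʳ; ∨-assoc)
open import Data.Empty using (⊥; ⊥-elim)
open import Data.Fin using (Fin; toℕ; splitAt; join; combine; remQuot) renaming (zero to fzero; suc to fsuc)
open import Data.Fin.Properties using (splitAt-join; remQuot-combine)
open import Data.List
  using (List; []; _∷_; _++_; length; map; replicate; reverse; _ʳ++_; drop; head; zipWith; concatMap; allFin; tabulate)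
open import Data.List.Properties
  using (length-map; ʳ++-defn; reverse-map; reverse-involutive; length-ʳ++; ++-identityʳ; ++-assoc;
         map-∘; map-cong; map-id; map-++; map-tabulate)
open import Data.Maybe using (Maybe; just; nothing)
open import Data.Nat using (ℕ; zero; suc; _+_; _*_; _^_; _∸_; _≤_; _<_; _≤?_; z≤n; s≤s)
open import Data.Nat.ListAction using (sum)
open import Data.Nat.Properties
  using (≤-refl; ≤-trans; ≤-reflexive; ≤-pred; n≤1+n; m≤n⇒m<n∨m≡n; <⇒≱; m≤n+m; m≤m+n; m+[n∸m]≡n; ≰⇒>;
         +-suc; +-comm; +-identityʳ; +-mono-≤; +-monoʳ-≤; +-monoˡ-≤; *-identityʳ; module ≤-Reasoning)
open import Data.Nat.Tactic.RingSolver using (solve-∀)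
open import Data.Product using (_×_; _,_; proj₁; proj₂; ∃-syntax)
open import Data.Sum using (_⊎_; inj₁; inj₂)
import Data.Sum as Sum
open import Data.Sum.Properties using (inj₂-injective)
open import Data.Unit using (⊤; tt)
open import Data.Vec using (Vec; toList) renaming (replicate to vreplicate; [] to []ᵥ; _∷_ to _∷ᵥ_)
open import Function using (_∘_)
open import Function.Bundles using (_⇔_; mk⇔)
open import Function.Construct.Composition using (_⇔-∘_)
open import Function.Construct.Symmetry using (⇔-sym)
open import Relation.Binary.PropositionalEquality
open import Relation.Nullary using (¬_; yes; no)

open import Defs

-- Attractor marks and the strategies

-- win₀ … win₃ of a state q: the ∃ team can force a win from q when the next bit
-- to be input is the first (b₀), second (b₁), third (m₀) or fourth (m₁) of a round.
record Marks : Set where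
  constructor marks
  field
    win₀ win₁ win₂ win₃ : Bool
open Marks

noMarks : Marks
noMarks = marks false false false false

_∪ᴹ_ : Marks → Marks → Marks
m ∪ᴹ n = marks (win₀ m ∨ win₀ n) (win₁ m ∨ win₁ n) (win₂ m ∨ win₂ n) (win₃ m ∨ win₃ n)

-- One-step attraction at a state with F∃ flag e and F∀ flag a whose 0- and
-- 1-successors carry m and n: ∀ picks the first two bits of a round, ∃ the last two.
attract : Bool → Bool → Marks → Marks → Marks
attract e a m n =
  marks (e ∨ (not a ∧ (win₁ m ∧ win₁ n))) (win₂ m ∧ win₂ n) (win₃ m ∨ win₃ n) (win₀ m ∨ win₀ n)

∨-introˡ : ∀ {a} b → a ≡ true → a ∨ b ≡ true
∨-introˡ _ refl = refl

∨-elim : ∀ a {b} → a ∨ b ≡ true → a ≡ true ⊎ b ≡ true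
∨-elim true  _ = inj₁ refl
∨-elim false e = inj₂ e

∧-elim : ∀ a {b} → a ∧ b ≡ true → a ≡ true × b ≡ true
∧-elim true e = refl , e

∨-absorbed : ∀ {a b} → a ∨ b ≡ a → a ≡ false → b ≡ false
∨-absorbed e refl = e

firstBit : List Bool → Bool
firstBit []      = false
firstBit (b ∷ _) = b

announce : ∀ n → Bool → Vec Bool n
announce zero    b = []ᵥ
announce (suc n) b = b ∷ᵥ vreplicate n false

firstBit-announce : ∀ n b → 1 ≤ n → firstBit (toList (announce n b)) ≡ b
firstBit-announce (suc n) b _ = refl

module Attractor (D : GameDFA) where
  open GameDFA D

  winMarks : ℕ → Fin nQ → Marks
  winMarks zero    q = noMarks
  winMarks (suc k) q =
    winMarks k q ∪ᴹ attract (F∃ q) (F∀ q) (winMarks k (δ q false)) (winMarks k (δ q true))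

  marked : (Marks → Bool) → ℕ → Fin nQ → Bool
  marked w k q = w (winMarks k q)

  Win : (Marks → Bool) → ℕ → Fin nQ → Set
  Win w k q = marked w k q ≡ true

  Win-both : ∀ w j q b → Win w j (δ q false) → Win w j (δ q true) → Win w j (δ q b)
  Win-both _ _ q false w₀ _  = w₀
  Win-both _ _ q true  _  w₁ = w₁

  roundState : Fin nQ → Bool → Bool → Bool → Bool → Fin nQ
  roundState q b₀ b₁ m₀ m₁ = δ (δ (δ (δ q b₀) b₁) m₀) m₁

  win₀-unfold : ∀ j q → Win win₀ (suc j) q →
    F∃ q ≡ true ⊎ (F∀ q ≡ false × Win win₁ j (δ q false) × Win win₁ j (δ q true))
  win₀-unfold j q w with ∨-elim (win₀ (winMarks j q)) w
  win₀-unfold (suc j) q w | inj₁ old with win₀-unfold j q old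
  ... | inj₁ inF∃            = inj₁ inF∃
  ... | inj₂ (notF∀ , w₀ , w₁) = inj₂ (notF∀ , ∨-introˡ _ w₀ , ∨-introˡ _ w₁)
  win₀-unfold j q w | inj₂ new with F∃ q | F∀ q
  ... | true  | _     = inj₁ refl
  ... | false | false = inj₂ (refl , ∧-elim _ new)

  win₁-unfold : ∀ j q → Win win₁ (suc j) q → Win win₂ j (δ q false) × Win win₂ j (δ q true)
  win₁-unfold j q w with ∨-elim (win₁ (winMarks j q)) w
  win₁-unfold (suc j) q w | inj₁ old with win₁-unfold j q old
  ... | w₀ , w₁ = ∨-introˡ _ w₀ , ∨-introˡ _ w₁
  win₁-unfold j q w | inj₂ new = ∧-elim _ new

  win₂-unfold : ∀ j q → Win win₂ (suc j) q → Win win₃ j (δ q false) ⊎ Win win₃ j (δ q true)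
  win₂-unfold j q w with ∨-elim (win₂ (winMarks j q)) w
  win₂-unfold (suc j) q w | inj₁ old with win₂-unfold j q old
  ... | inj₁ w₀ = inj₁ (∨-introˡ _ w₀)
  ... | inj₂ w₁ = inj₂ (∨-introˡ _ w₁)
  win₂-unfold j q w | inj₂ new = ∨-elim _ new

  win₃-unfold : ∀ j q → Win win₃ (suc j) q → Win win₀ j (δ q false) ⊎ Win win₀ j (δ q true)
  win₃-unfold j q w with ∨-elim (win₃ (winMarks j q)) w
  win₃-unfold (suc j) q w | inj₁ old with win₃-unfold j q old
  ... | inj₁ w₀ = inj₁ (∨-introˡ _ w₀)
  ... | inj₂ w₁ = inj₂ (∨-introˡ _ w₁)
  win₃-unfold j q w | inj₂ new = ∨-elim _ new

  towards : (Fin nQ → Bool) → Fin nQ → Bool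
  towards good q = not (good (δ q false))

  towards-good : ∀ (good : Fin nQ → Bool) q → good (δ q false) ≡ true ⊎ good (δ q true) ≡ true →
                 good (δ q (towards good q)) ≡ true
  towards-good good q g with good (δ q false) in g₀
  ... | true  = g₀
  ... | false with g
  ...   | inj₁ ()
  ...   | inj₂ g₁ = g₁

  -- ∃'s reply (m₀ , m₁) to ∀'s bits in a round that starts at q with budget B:
  -- each bit moves towards the marks one level lower.
  existsReply : ℕ → Fin nQ → Bool → Bool → Bool × Bool
  existsReply B q b₀ b₁ = m₀ , towards (marked win₀ (B ∸ 4)) (δ q₂ m₀)
    where
    q₂ = δ (δ q b₀) b₁
    m₀ = towards (marked win₃ (B ∸ 3)) q₂

  respond : ℕ → Fin nQ → Bool → Bool → Fin nQ
  respond B q b₀ b₁ = roundState q b₀ b₁ (proj₁ (existsReply B q b₀ b₁)) (proj₂ (existsReply B q b₀ b₁))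

  respond-progress : ∀ B q b₀ b₁ → Win win₀ B q →
    F∃ q ≡ true ⊎ (F∀ q ≡ false × ∃[ j ] B ≡ 4 + j × Win win₀ j (respond B q b₀ b₁))
  respond-progress zero q b₀ b₁ ()
  respond-progress (suc j) q b₀ b₁ w with win₀-unfold j q w
  ... | inj₁ inF∃               = inj₁ inF∃
  ... | inj₂ (notF∀ , w₀ , w₁) = inj₂ (notF∀ , fromB₀ j (Win-both win₁ j q b₀ w₀ w₁))
    where
    afterB₁ : ∀ j → Win win₁ (suc j) (δ q b₀) → Win win₂ j (δ (δ q b₀) b₁)
    afterB₁ j w = Win-both win₂ j (δ q b₀) b₁ (proj₁ (win₁-unfold j _ w)) (proj₂ (win₁-unfold j _ w))
    afterM₀ : ∀ j q₂ → Win win₂ (suc j) q₂ → Win win₃ j (δ q₂ (towards (marked win₃ j) q₂))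
    afterM₀ j q₂ w = towards-good (marked win₃ j) q₂ (win₂-unfold j q₂ w)
    afterM₁ : ∀ j q₃ → Win win₃ (suc j) q₃ → Win win₀ j (δ q₃ (towards (marked win₀ j) q₃))
    afterM₁ j q₃ w = towards-good (marked win₀ j) q₃ (win₃-unfold j q₃ w)
    fromB₀ : ∀ j → Win win₁ j (δ q b₀) → ∃[ j' ] suc j ≡ 4 + j' × Win win₀ j' (respond (suc j) q b₀ b₁)
    fromB₀ zero ()
    fromB₀ (suc zero) w with afterB₁ zero w
    ... | ()
    fromB₀ (suc (suc zero)) w with afterM₀ zero (δ (δ q b₀) b₁) (afterB₁ (suc zero) w)
    ... | ()
    fromB₀ (suc (suc (suc j))) w =
      j , refl , afterM₁ j _ (afterM₀ (suc j) (δ (δ q b₀) b₁) (afterB₁ (suc (suc j)) w))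

  module ExistsWins (P : Policy) (midPositive : MidPositive P) (K : ℕ) where

    budget : ℕ → ℕ
    budget zero    = K
    budget (suc r) = budget r ∸ 4

    replay : List View → Fin nQ
    replay []      = q₀
    replay (v ∷ h) = respond (budget (length h)) (replay h) (firstBit (View.x0 v)) (firstBit (View.x1 v))

    component : Fin 2 → Bool × Bool → Bool
    component fzero    = proj₁
    component (fsuc _) = proj₂

    -- Each ∃ player announces its bit from ∀ as the first bit of its mid-round
    -- message, so both replay the same play and compute the same reply.
    strategy : (i : Fin 2) → ExStrategy P i
    strategy i = record
      { midMsg  = λ h b → announce _ b
      ; moveBit = λ h _ x₀ x₁ →
          component i (existsReply (budget (length h)) (replay h) (firstBit x₀) (firstBit x₁))
      ; endMsg  = λ h _ _ _ _ → vreplicate _ false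
      }

    module Against (σ : UniStrategy) where
      open Play P (strategy fzero) (strategy (fsuc fzero)) σ

      state : ℕ → Fin nQ
      state r = dfaState D (hist r)

      views : Fin 2 → ℕ → List View
      views i r = map (viewOf i) (hist r)

      length-hist : ∀ r → length (hist r) ≡ r
      length-hist zero    = refl
      length-hist (suc r) = cong suc (length-hist r)

      length-views : ∀ i r → length (views i r) ≡ r
      length-views i r = trans (length-map (viewOf i) (hist r)) (length-hist r)

      announced₀ : ∀ r → firstBit (Round.x0 (nextRound (hist r))) ≡ proj₁ (σ (hist r))
      announced₀ r = firstBit-announce _ _ (proj₁ (midPositive (pstate P (length (views fzero r)))))

      announced₁ : ∀ r → firstBit (Round.x1 (nextRound (hist r))) ≡ proj₂ (σ (hist r))
      announced₁ r = firstBit-announce _ _ (proj₂ (midPositive (pstate P (length (views (fsuc fzero) r)))))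

      cong₄ : ∀ {A : Set} (f : ℕ → Fin nQ → Bool → Bool → A) {n n' q q' c₀ c₀' c₁ c₁'} →
              n ≡ n' → q ≡ q' → c₀ ≡ c₀' → c₁ ≡ c₁' → f n q c₀ c₁ ≡ f n' q' c₀' c₁'
      cong₄ f refl refl refl refl = refl

      replay-views : ∀ i r → replay (views i r) ≡ state r
      state-suc : ∀ r → state (suc r) ≡ respond (budget r) (state r) (proj₁ (σ (hist r))) (proj₂ (σ (hist r)))

      replay-views i        zero    = refl
      replay-views fzero    (suc r) =
        trans (cong₄ (respond ∘ budget) (length-views fzero r) (replay-views fzero r) (announced₀ r) (announced₁ r))
              (sym (state-suc r))
      replay-views (fsuc k) (suc r) =
        trans (cong₄ (respond ∘ budget) (length-views (fsuc k) r) (replay-views (fsuc k) r) (announced₀ r) (announced₁ r))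
              (sym (state-suc r))

      state-suc r = cong₂ (roundState (state r) (proj₁ (σ (hist r))) (proj₂ (σ (hist r))))
        (cong proj₁ (agree fzero)) (cong proj₂ (agree (fsuc fzero)))
        where
        agree : ∀ i → existsReply (budget (length (views i r))) (replay (views i r))
                        (firstBit (Round.x0 (nextRound (hist r)))) (firstBit (Round.x1 (nextRound (hist r))))
                    ≡ existsReply (budget r) (state r) (proj₁ (σ (hist r))) (proj₂ (σ (hist r)))
        agree i = cong₄ (existsReply ∘ budget) (length-views i r) (replay-views i r) (announced₀ r) (announced₁ r)

      WinsFrom : ℕ → Set
      WinsFrom r = ∃[ r' ] F∃ (state r') ≡ true × (∀ r'' → r ≤ r'' → r'' < r' → F∀ (state r'') ≡ false)

      progress : ∀ d r → budget r < d → Win win₀ (budget r) (state r) → WinsFrom r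
      progress zero r () w
      progress (suc d) r lt w
        with respond-progress (budget r) (state r) (proj₁ (σ (hist r))) (proj₂ (σ (hist r))) w
      ... | inj₁ inF∃ = r , inF∃ , λ r'' r≤r'' r''<r → ⊥-elim (<⇒≱ r''<r r≤r'')
      ... | inj₂ (notF∀ , j , eq , w')
        with progress d (suc r) (subst (_< d) (cong (_∸ 4) (sym eq)) j<d)
                        (subst₂ (Win win₀) (cong (_∸ 4) (sym eq)) (sym (state-suc r)) w')
        where
        j<d : j < d
        j<d = ≤-trans (s≤s (m≤n+m j 3)) (≤-pred (subst (_< suc d) eq lt))
      ... | r' , inF∃ , safe = r' , inF∃ , extend
        where
        extend : ∀ r'' → r ≤ r'' → r'' < r' → F∀ (state r'') ≡ false
        extend r'' r≤r'' r''<r' with m≤n⇒m<n∨m≡n r≤r''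
        ... | inj₁ r<r'' = safe r'' r<r'' r''<r'
        ... | inj₂ refl  = notF∀

    forcedWin : Win win₀ K q₀ → ForcedWin D P
    forcedWin w = strategy fzero , strategy (fsuc fzero) , λ σ → fromStart σ (Against.progress σ (suc K) 0 ≤-refl w)
      where
      fromStart : ∀ σ → Against.WinsFrom σ 0 →
        ∃[ r ] F∃ (Against.state σ r) ≡ true × (∀ r' → r' < r → F∀ (Against.state σ r') ≡ false)
      fromStart σ (r , inF∃ , safe) = r , inF∃ , λ r' → safe r' z≤n

  module UniversalWins (P : Policy) (X : Fin nQ → Marks)
    (closed : ∀ q → X q ∪ᴹ attract (F∃ q) (F∀ q) (X (δ q false)) (X (δ q true)) ≡ X q)
    (lost : win₀ (X q₀) ≡ false) where

    avoid : (Fin nQ → Bool) → Fin nQ → Bool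
    avoid good q = good (δ q false)

    avoid-bad : ∀ (good : Fin nQ → Bool) q → good (δ q false) ∧ good (δ q true) ≡ false →
                good (δ q (avoid good q)) ≡ false
    avoid-bad good q g with good (δ q false) in g₀
    ... | false = g₀
    ... | true  = g

    both-bad : ∀ (good : Fin nQ → Bool) q → good (δ q false) ∨ good (δ q true) ≡ false →
               ∀ b → good (δ q b) ≡ false
    both-bad good q g false = ∨-conicalˡ _ _ g
    both-bad good q g true  = ∨-conicalʳ _ _ g

    spoilerBits : Fin nQ → Bool × Bool
    spoilerBits q = b₀ , avoid (win₂ ∘ X) (δ q b₀)
      where
      b₀ = avoid (win₁ ∘ X) q

    spoiler : UniStrategy
    spoiler h = spoilerBits (dfaState D h)

    stays-unmarked : ∀ q m₀ m₁ → win₀ (X q) ≡ false → F∀ q ≡ false →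
      win₀ (X (roundState q (proj₁ (spoilerBits q)) (proj₂ (spoilerBits q)) m₀ m₁)) ≡ false
    stays-unmarked q m₀ m₁ u notF∀ = both-bad (win₀ ∘ X) q₃ (∨-absorbed (cong win₃ (closed q₃)) u₃) m₁
      where
      attract₀ : not (F∀ q) ∧ (win₁ (X (δ q false)) ∧ win₁ (X (δ q true))) ≡ false
      attract₀ = ∨-conicalʳ _ _ (∨-absorbed (cong win₀ (closed q)) u)
      q₁ = δ q (avoid (win₁ ∘ X) q)
      u₁ : win₁ (X q₁) ≡ false
      u₁ = avoid-bad (win₁ ∘ X) q (subst (λ a → not a ∧ _ ≡ false) notF∀ attract₀)
      q₂ = δ q₁ (avoid (win₂ ∘ X) q₁)
      u₂ : win₂ (X q₂) ≡ false
      u₂ = avoid-bad (win₂ ∘ X) q₁ (∨-absorbed (cong win₁ (closed q₁)) u₁)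
      q₃ = δ q₂ m₀
      u₃ : win₃ (X q₃) ≡ false
      u₃ = both-bad (win₃ ∘ X) q₂ (∨-absorbed (cong win₂ (closed q₂)) u₂) m₀

    unmarked-notF∃ : ∀ q → win₀ (X q) ≡ false → F∃ q ≡ false
    unmarked-notF∃ q u = ∨-conicalˡ _ _ (∨-absorbed (cong win₀ (closed q)) u)

    module Against (s₀ : ExStrategy P fzero) (s₁ : ExStrategy P (fsuc fzero)) where
      open Play P s₀ s₁ spoiler

      state : ℕ → Fin nQ
      state r = dfaState D (hist r)

      unmarked : ∀ r → (∀ r' → r' < r → F∀ (state r') ≡ false) → win₀ (X (state r)) ≡ false
      unmarked zero    _    = lost
      unmarked (suc r) safe =
        stays-unmarked (state r) _ _ (unmarked r λ r' lt → safe r' (≤-trans lt (n≤1+n r))) (safe r ≤-refl)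

    notForcedWin : ¬ ForcedWin D P
    notForcedWin (s₀ , s₁ , wins) with wins spoiler
    ... | r , inF∃ , safe with trans (sym (unmarked-notF∃ _ (Against.unmarked s₀ s₁ r safe))) inF∃
    ... | ()

  StableAt : ℕ → Set
  StableAt K = ∀ q → winMarks (suc K) q ≡ winMarks K q

  forcedWin⇔ : ∀ P → MidPositive P → ∀ K → StableAt K →
               ForcedWin D P ⇔ Win win₀ K q₀
  forcedWin⇔ P midPositive K stable = mk⇔ decided (ExistsWins.forcedWin P midPositive K)
    where
    decided : ForcedWin D P → Win win₀ K q₀
    decided fw with win₀ (winMarks K q₀) in e
    ... | true  = refl
    ... | false = ⊥-elim (UniversalWins.notForcedWin P (winMarks K) stable e fw)

-- Sweep machines

record Finite (A : Set) : Set where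
  field
    size          : ℕ
    index         : A → Fin size
    element       : Fin size → A
    element-index : ∀ a → element (index a) ≡ a
open Finite

Finite-Fin : ∀ n → Finite (Fin n)
Finite-Fin n = record { size = n ; index = λ i → i ; element = λ i → i ; element-index = λ _ → refl }

Finite-⊤ : Finite ⊤
Finite-⊤ = record { size = 1 ; index = λ _ → fzero ; element = λ _ → tt ; element-index = λ _ → refl }

Finite-Bool : Finite Bool
Finite-Bool = record { size = 2 ; index = index′ ; element = element′ ; element-index = element-index′ }
  where
  index′ : Bool → Fin 2
  index′ false = fzero
  index′ true  = fsuc fzero
  element′ : Fin 2 → Bool
  element′ fzero    = false
  element′ (fsuc _) = true
  element-index′ : ∀ b → element′ (index′ b) ≡ b
  element-index′ false = refl
  element-index′ true  = refl

Finite-⊎ : ∀ {A B} → Finite A → Finite B → Finite (A ⊎ B)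
Finite-⊎ {A} {B} FA FB = record
  { size = size FA + size FB ; index = index′ ; element = element′ ; element-index = element-index′ }
  where
  index′ : A ⊎ B → Fin (size FA + size FB)
  index′ x = join (size FA) (size FB) (Sum.map (index FA) (index FB) x)
  element′ : Fin (size FA + size FB) → A ⊎ B
  element′ i = Sum.map (element FA) (element FB) (splitAt (size FA) i)
  element-index′ : ∀ x → element′ (index′ x) ≡ x
  element-index′ (inj₁ a) rewrite splitAt-join (size FA) (size FB) (inj₁ (index FA a)) = cong inj₁ (element-index FA a)
  element-index′ (inj₂ b) rewrite splitAt-join (size FA) (size FB) (inj₂ (index FB b)) = cong inj₂ (element-index FB b)

Finite-× : ∀ {A B} → Finite A → Finite B → Finite (A × B)
Finite-× {A} {B} FA FB = record
  { size = size FA * size FB ; index = index′ ; element = element′ ; element-index = element-index′ }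
  where
  index′ : A × B → Fin (size FA * size FB)
  index′ (a , b) = combine (index FA a) (index FB b)
  element′ : Fin (size FA * size FB) → A × B
  element′ i = element FA (proj₁ (remQuot {size FA} (size FB) i)) , element FB (proj₂ (remQuot {size FA} (size FB) i))
  element-index′ : ∀ x → element′ (index′ x) ≡ x
  element-index′ (a , b) =
    trans (cong (λ jk → element FA (proj₁ jk) , element FB (proj₂ jk))
                (remQuot-combine {size FA} {size FB} (index FA a) (index FB b)))
          (cong₂ _,_ (element-index FA a) (element-index FB b))

Finite-retract : ∀ {A B} → Finite A → (f : A → B) (g : B → A) → (∀ b → f (g b) ≡ b) → Finite B
Finite-retract FA f g fg = record
  { size = size FA ; index = λ b → index FA (g b) ; element = λ i → f (element FA i)
  ; element-index = λ b → trans (cong f (element-index FA (g b))) (fg b) }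

sweep : {S C : Set} → (S → C → S × C) → S → List C → S × List C
sweep f s []       = s , []
sweep f s (c ∷ cs) = proj₁ (sweep f (proj₁ (f s c)) cs) , proj₂ (f s c) ∷ proj₂ (sweep f (proj₁ (f s c)) cs)

length-sweep : {S C : Set} (f : S → C → S × C) (s : S) (cs : List C) →
               length (proj₂ (sweep f s cs)) ≡ length cs
length-sweep f s []       = refl
length-sweep f s (c ∷ cs) = cong suc (length-sweep f _ cs)

-- A sweep machine runs in phases.  Phase p moves the head from the left end of
-- the tape content to the right end, rewriting every cell by the transducer δ p
-- started in start p; at the blank behind the content, next p decides whether to
-- halt or to walk back to the left end and run another phase.  Cells are coded
-- as tape symbols by fsuc ∘ code, which keeps symbol 0 free as the end marker.
module SweepMachine
  (E : ℕ) (Cell : Set)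
  (code : Cell → Fin (2 + E)) (decode : Fin (2 + E) → Cell) (decode-code : ∀ c → decode (code c) ≡ c)
  (input : Bool → Cell) (code-input₀ : code (input false) ≡ fzero) (code-input₁ : code (input true) ≡ fsuc fzero)
  (Phase State : Set) (finitePhase : Finite Phase) (finiteState : Finite State)
  (δ : Phase → State → Cell → State × Cell) (start : Phase → State) (next : Phase → State → Phase ⊎ Bool)
  (p₀ : Phase)
  where

  data Control : Set where
    goRight : Phase → State → Control
    goLeft  : Phase → Control

  finiteControl : Finite Control
  finiteControl = Finite-retract (Finite-⊎ (Finite-× finitePhase finiteState) finitePhase) fromSum toSum fromSum-toSum
    where
    fromSum : (Phase × State) ⊎ Phase → Control
    fromSum (inj₁ (p , t)) = goRight p t
    fromSum (inj₂ p)       = goLeft p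
    toSum : Control → (Phase × State) ⊎ Phase
    toSum (goRight p t) = inj₁ (p , t)
    toSum (goLeft p)    = inj₂ p
    fromSum-toSum : ∀ c → fromSum (toSum c) ≡ c
    fromSum-toSum (goRight p t) = refl
    fromSum-toSum (goLeft p)    = refl

  Symbol : Set
  Symbol = Fin (3 + E)

  symbol : Cell → Symbol
  symbol c = fsuc (code c)

  ⌜_⌝ : Control → Fin (size finiteControl)
  ⌜ c ⌝ = index finiteControl c

  transition : Control → Symbol → (Fin (size finiteControl) × Symbol × Move) ⊎ Bool
  transition (goRight p t) fzero with next p t
  ... | inj₂ b  = inj₂ b
  ... | inj₁ p' = inj₁ (⌜ goLeft p' ⌝ , fzero , moveL)
  transition (goRight p t) (fsuc a) =
    inj₁ (⌜ goRight p (proj₁ (δ p t (decode a))) ⌝ , symbol (proj₂ (δ p t (decode a))) , moveR)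
  transition (goLeft p) fzero    = inj₁ (⌜ goRight p (start p) ⌝ , fzero , moveR)
  transition (goLeft p) (fsuc a) = inj₁ (⌜ goLeft p ⌝ , fsuc a , moveL)

  machine : TM
  machine = record
    { nStates = size finiteControl ; nExtra = E ; start = ⌜ goRight p₀ (start p₀) ⌝
    ; trans = λ s a → transition (element finiteControl s) a }

  open Machine machine public renaming (init to initial; sym to inputSymbol)

  transition-goRight : ∀ p t c → TM.trans machine (⌜ goRight p t ⌝) (symbol c)
    ≡ inj₁ (⌜ goRight p (proj₁ (δ p t c)) ⌝ , symbol (proj₂ (δ p t c)) , moveR)
  transition-goRight p t c rewrite element-index finiteControl (goRight p t) | decode-code c = refl

  transition-halt : ∀ p t b → next p t ≡ inj₂ b → TM.trans machine (⌜ goRight p t ⌝) fzero ≡ inj₂ b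
  transition-halt p t b e rewrite element-index finiteControl (goRight p t) | e = refl

  transition-turn : ∀ p t p' → next p t ≡ inj₁ p' →
                    TM.trans machine (⌜ goRight p t ⌝) fzero ≡ inj₁ (⌜ goLeft p' ⌝ , fzero , moveL)
  transition-turn p t p' e rewrite element-index finiteControl (goRight p t) | e = refl

  transition-goLeft : ∀ p c → TM.trans machine (⌜ goLeft p ⌝) (symbol c) ≡ inj₁ (⌜ goLeft p ⌝ , symbol c , moveL)
  transition-goLeft p c rewrite element-index finiteControl (goLeft p) = refl

  transition-restart : ∀ p → TM.trans machine (⌜ goLeft p ⌝) fzero ≡ inj₁ (⌜ goRight p (start p) ⌝ , fzero , moveR)
  transition-restart p rewrite element-index finiteControl (goLeft p) = refl

  at : Fin (size finiteControl) → List Symbol → List Symbol → Config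
  at s l []      = cfg s l fzero []
  at s l (a ∷ r) = cfg s l a r

  atˡ : Fin (size finiteControl) → List Symbol → List Symbol → Config
  atˡ s []      r = cfg s [] fzero r
  atˡ s (a ∷ l) r = cfg s l a r

  step-moveR : ∀ {s a s' a'} l r → TM.trans machine s a ≡ inj₁ (s' , a' , moveR) →
               step (cfg s l a r) ≡ inj₁ (at s' (a' ∷ l) r)
  step-moveR l []      e rewrite e = refl
  step-moveR l (_ ∷ r) e rewrite e = refl

  step-moveL : ∀ {s a s' a'} l r → TM.trans machine s a ≡ inj₁ (s' , a' , moveL) →
               step (cfg s l a r) ≡ inj₁ (atˡ s' l (a' ∷ r))
  step-moveL []      r e rewrite e = refl
  step-moveL (_ ∷ l) r e rewrite e = refl

  step-halt : ∀ {s a b} l r → TM.trans machine s a ≡ inj₂ b → step (cfg s l a r) ≡ inj₂ b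
  step-halt l r e rewrite e = refl

  continueRun : ℕ → Config ⊎ Bool → Config ⊎ Bool
  continueRun n (inj₁ c) = run n c
  continueRun n (inj₂ b) = inj₂ b

  run-+ : ∀ m n c → run (m + n) c ≡ continueRun n (run m c)
  run-+ zero    n c = refl
  run-+ (suc m) n c with step c
  ... | inj₁ c' = run-+ m n c'
  ... | inj₂ b  = refl

  Reaches : Config → Config → Set
  Reaches c c' = ∃[ n ] run n c ≡ inj₁ c'

  reaches-refl : ∀ {c} → Reaches c c
  reaches-refl = 0 , refl

  reaches-trans : ∀ {c c' c''} → Reaches c c' → Reaches c' c'' → Reaches c c''
  reaches-trans {c} (m , r) (n , r') = m + n , trans (run-+ m n c) (trans (cong (continueRun n) r) r')

  run-1 : ∀ c → run 1 c ≡ continueRun 0 (step c)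
  run-1 c with step c
  ... | inj₁ _ = refl
  ... | inj₂ _ = refl

  reaches-step : ∀ {c c'} → step c ≡ inj₁ c' → Reaches c c'
  reaches-step {c} e = 1 , trans (run-1 c) (cong (continueRun 0) e)

  -- The visited blanks beside the content: none before the first phase, one on
  -- each side after every turn.
  data Margin : List Symbol → Set where
    noBlank  : Margin []
    oneBlank : Margin (fzero ∷ [])

  length-margin : ∀ {m} → Margin m → length m ≤ 1
  length-margin noBlank  = z≤n
  length-margin oneBlank = s≤s z≤n

  sweepRight : ∀ p t cs l {rest} → Margin rest →
    Reaches (at ⌜ goRight p t ⌝ l (map symbol cs ++ rest))
            (cfg ⌜ goRight p (proj₁ (sweep (δ p) t cs)) ⌝ (map symbol (proj₂ (sweep (δ p) t cs)) ʳ++ l) fzero [])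
  sweepRight p t []       l noBlank  = reaches-refl
  sweepRight p t []       l oneBlank = reaches-refl
  sweepRight p t (c ∷ cs) l m =
    reaches-trans (reaches-step (step-moveR l (map symbol cs ++ _) (transition-goRight p t c)))
                  (sweepRight p (proj₁ (δ p t c)) cs (symbol (proj₂ (δ p t c)) ∷ l) m)

  sweepLeft : ∀ p zs r {lp} → Margin lp →
    Reaches (atˡ ⌜ goLeft p ⌝ (map symbol zs ++ lp) r) (cfg ⌜ goLeft p ⌝ [] fzero (map symbol zs ʳ++ r))
  sweepLeft p []       r noBlank  = reaches-refl
  sweepLeft p []       r oneBlank = reaches-refl
  sweepLeft p (z ∷ zs) r m =
    reaches-trans (reaches-step (step-moveL (map symbol zs ++ _) r (transition-goLeft p z))) (sweepLeft p zs (symbol z ∷ r) m)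

  map-ʳ++ : ∀ (Y : List Cell) l → map symbol Y ʳ++ l ≡ map symbol (reverse Y) ++ l
  map-ʳ++ Y l = trans (ʳ++-defn (map symbol Y)) (cong (_++ l) (sym (reverse-map symbol Y)))

  turn : ∀ {p t p'} → next p t ≡ inj₁ p' → ∀ Y {lp} → Margin lp →
    Reaches (cfg ⌜ goRight p t ⌝ (map symbol Y ʳ++ lp) fzero [])
            (at ⌜ goRight p' (start p') ⌝ (fzero ∷ []) (map symbol Y ++ fzero ∷ []))
  turn {p} {t} {p'} e Y {lp} m =
    reaches-trans (reaches-step (trans (step-moveL _ [] (transition-turn p t p' e))
                                       (cong (λ l → inj₁ (atˡ ⌜ goLeft p' ⌝ l (fzero ∷ []))) (map-ʳ++ Y lp))))
   (reaches-trans (sweepLeft p' (reverse Y) (fzero ∷ []) m)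
                  (reaches-step (trans (step-moveR [] _ (transition-restart p'))
                                       (cong (λ r → inj₁ (at ⌜ goRight p' (start p') ⌝ (fzero ∷ []) r)) returned))))
    where
    returned : map symbol (reverse Y) ʳ++ (fzero ∷ []) ≡ map symbol Y ++ fzero ∷ []
    returned = trans (map-ʳ++ (reverse Y) _) (cong (λ Z → map symbol Z ++ fzero ∷ []) (reverse-involutive Y))

  space-at-end : ∀ s (Y : List Cell) {lp} → Margin lp → space (cfg s (map symbol Y ʳ++ lp) fzero []) ≤ length Y + 2
  space-at-end s Y {lp} m = begin
    suc (length (map symbol Y ʳ++ lp) + 0) ≡⟨ cong suc (+-identityʳ _) ⟩
    suc (length (map symbol Y ʳ++ lp))     ≡⟨ cong suc (length-ʳ++ (map symbol Y)) ⟩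
    suc (length (map symbol Y) + length lp) ≡⟨ cong (λ k → suc (k + length lp)) (length-map symbol Y) ⟩
    suc (length Y + length lp)             ≤⟨ s≤s (+-monoʳ-≤ (length Y) (length-margin m)) ⟩
    suc (length Y + 1)                     ≡⟨ sym (+-suc (length Y) 1) ⟩
    length Y + 2                           ∎
    where open ≤-Reasoning

  data Sweeps : Phase → List Cell → Bool → Set where
    halts     : ∀ {p Y b} → next p (proj₁ (sweep (δ p) (start p) Y)) ≡ inj₂ b → Sweeps p Y b
    continues : ∀ {p Y b p'} → next p (proj₁ (sweep (δ p) (start p) Y)) ≡ inj₁ p' →
                Sweeps p' (proj₂ (sweep (δ p) (start p) Y)) b → Sweeps p Y b

  HaltsFrom : Config → Bool → ℕ → Set
  HaltsFrom c b n = ∃[ c' ] Reaches c c' × step c' ≡ inj₂ b × space c' ≤ n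

  halts-of-sweeps : ∀ {p Y b} → Sweeps p Y b → ∀ {lp rp} → Margin lp → Margin rp →
    HaltsFrom (at ⌜ goRight p (start p) ⌝ lp (map symbol Y ++ rp)) b (length Y + 2)
  halts-of-sweeps {p} {Y} (halts e) {lp} ml mr =
    _ , sweepRight p (start p) Y _ mr , step-halt _ [] (transition-halt p _ _ e) ,
    subst (λ n → space (cfg ⌜ goRight p t ⌝ (map symbol Y' ʳ++ lp) fzero []) ≤ n + 2)
          (length-sweep (δ p) (start p) Y) (space-at-end ⌜ goRight p t ⌝ Y' ml)
    where
    t  = proj₁ (sweep (δ p) (start p) Y)
    Y' = proj₂ (sweep (δ p) (start p) Y)
  halts-of-sweeps {p} {Y} (continues e s) ml mr with halts-of-sweeps s oneBlank oneBlank
  ... | c , reach , halt , bound =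
    c , reaches-trans (sweepRight p (start p) Y _ mr) (reaches-trans (turn e _ ml) reach) ,
    halt , subst (λ n → space c ≤ n + 2) (length-sweep (δ p) (start p) Y) bound

  shift-space : ∀ d l a r → length l + length r ≤ length (proj₁ (shift d l a r)) + length (proj₂ (proj₂ (shift d l a r)))
  shift-space moveL []      a r       = n≤1+n (length r)
  shift-space moveL (c ∷ l) a r       = ≤-reflexive (sym (+-suc (length l) (length r)))
  shift-space moveR l       a []      = n≤1+n (length l + 0)
  shift-space moveR l       a (c ∷ r) = ≤-reflexive (+-suc (length l) (length r))
  shift-space stay  l       a r       = ≤-refl

  step-space : ∀ c {c'} → step c ≡ inj₁ c' → space c ≤ space c'
  step-space (cfg s l a r) e with TM.trans machine s a
  step-space (cfg s l a r) () | inj₂ b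
  ... | inj₁ (s' , a' , d) with shift d l a' r in sh
  step-space (cfg s l a r) refl | inj₁ (s' , a' , d) | l' , a'' , r' =
    s≤s (subst (λ x → length l + length r ≤ length (proj₁ x) + length (proj₂ (proj₂ x))) sh (shift-space d l a' r))

  run-space : ∀ n c {c'} → run n c ≡ inj₁ c' → space c ≤ space c'
  run-space zero    c refl = ≤-refl
  run-space (suc n) c r with step c in e
  ... | inj₁ c₁ = ≤-trans (step-space c e) (run-space n c₁ r)
  run-space (suc n) c () | inj₂ _

  reaches-space : ∀ {c c'} → Reaches c c' → space c ≤ space c'
  reaches-space {c} (n , r) = run-space n c r

  run-after-halt : ∀ {m t c b} → m ≤ t → run m c ≡ inj₂ b → run t c ≡ inj₂ b
  run-after-halt {m} {t} {c} {b} m≤t halted = begin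
    run t c                       ≡⟨ cong (λ k → run k c) (m+[n∸m]≡n m≤t) ⟨
    run (m + (t ∸ m)) c           ≡⟨ run-+ m (t ∸ m) c ⟩
    continueRun (t ∸ m) (run m c) ≡⟨ cong (continueRun (t ∸ m)) halted ⟩
    inj₂ b                        ∎
    where open ≡-Reasoning

  halt-unique : ∀ m n c {b b'} → run m c ≡ inj₂ b → run n c ≡ inj₂ b' → b ≡ b'
  halt-unique m n c rm rn = inj₂-injective (trans (sym (run-after-halt (m≤m+n m n) rm)) (run-after-halt (m≤n+m n m) rn))

  halts-within : ∀ c {b n} → HaltsFrom c b n →
    (∃[ t ] run t c ≡ inj₂ b) × (∀ t c' → run t c ≡ inj₁ c' → space c' ≤ n)
  halts-within c {b} {n} (c' , (m , reach) , halt , bound) = (suc m , halted) , within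
    where
    halted : run (suc m) c ≡ inj₂ b
    halted = trans (cong (λ k → run k c) (+-comm 1 m))
                   (trans (run-+ m 1 c) (trans (cong (continueRun 1) reach) (trans (run-1 c') (cong (continueRun 0) halt))))
    within : ∀ t c'' → run t c ≡ inj₁ c'' → space c'' ≤ n
    within t c'' rt with t ≤? m
    ... | yes t≤m = ≤-trans (reaches-space (m ∸ t , rest)) bound
      where
      rest : run (m ∸ t) c'' ≡ inj₁ c'
      rest = trans (sym (cong (continueRun (m ∸ t)) rt))
                   (trans (sym (run-+ t (m ∸ t) c)) (trans (cong (λ k → run k c) (m+[n∸m]≡n t≤m)) reach))
    ... | no t≰m with trans (sym rt) (run-after-halt (≰⇒> t≰m) halted)
    ...   | ()

  module Decides (decide : List Bool → Bool) (sweeps : ∀ w → Sweeps p₀ (map input w) (decide w)) where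

    initial-at : ∀ w → initial w ≡ at ⌜ goRight p₀ (start p₀) ⌝ [] (map symbol (map input w) ++ [])
    initial-at []      = refl
    initial-at (x ∷ w) = cong₂ (cfg _ []) (symbol-input x)
      (trans (map-cong symbol-input w) (trans (map-∘ w) (sym (++-identityʳ _))))
      where
      symbol-input : ∀ x → inputSymbol x ≡ symbol (input x)
      symbol-input false = cong fsuc (sym code-input₀)
      symbol-input true  = cong fsuc (sym code-input₁)

    haltsFrom-initial : ∀ w → HaltsFrom (initial w) (decide w) (length w + 2)
    haltsFrom-initial w = subst₂ (λ c n → HaltsFrom c (decide w) (n + 2)) (sym (initial-at w)) (length-map input w)
                                 (halts-of-sweeps (sweeps w) noBlank noBlank)

    linear-bound : ∀ m → m + 2 ≤ 2 * suc m ^ 1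
    linear-bound m = begin
      m + 2         ≤⟨ m≤m+n (m + 2) m ⟩
      m + 2 + m     ≡⟨ rearrange m ⟩
      2 * suc m     ≡⟨ cong (2 *_) (*-identityʳ (suc m)) ⟨
      2 * suc m ^ 1 ∎
      where
      open ≤-Reasoning
      rearrange : ∀ m → m + 2 + m ≡ 2 * suc m
      rearrange = solve-∀

    haltsWithinSpace : ∀ w → HaltsWithinSpace w (2 * suc (length w) ^ 1)
    haltsWithinSpace w with halts-within (initial w) (haltsFrom-initial w)
    ... | (t , halted) , within = (t , decide w , halted) , λ t' c r → ≤-trans (within t' c r) (linear-bound (length w))

    accepts⇔ : ∀ w → Accepts w ⇔ decide w ≡ true
    accepts⇔ w with halts-within (initial w) (haltsFrom-initial w)
    ... | (t , halted) , _ = mk⇔ (λ (t' , accepted) → halt-unique t t' (initial w) halted accepted)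
                                 (λ e → t , trans halted (cong inj₂ e))

-- A sweep machine for the fixpoint

-- The tape after parsing: a header, the start field, and one block per state q:
-- fields pointing to δ q 0 and δ q 1, the F∃ flag, and a cell with the F∀ flag,
-- the read cursor and the marks of q.  A field is a unary pointer of tally
-- cells (true once counted down) closed by a fieldEnd cell that receives the
-- marks of the state it points to.
data Cell : Set where
  input    : Bool → Cell
  header   : Cell
  tally    : Bool → Cell
  fieldEnd : Bool → Marks → Cell
  flag∃    : Bool → Cell
  blockEnd : Bool → Bool → Marks → Cell

data Phase : Set where
  parse reset read update : Phase
  apply : Marks → Phase

data ParsePos : Set where
  atHeader atStart atBlock inFieldA atFieldB atFlag∃ atFlag∀ malformed : ParsePos

data UpdatePos : Set where
  atStartField atFieldA atFieldB : UpdatePos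

data State : Set where
  parsing   : ParsePos → State
  resetting : Bool → State
  reading   : Bool → Marks → Bool → State
  applying  : Marks → Bool → State
  updating  : UpdatePos → Marks → Marks → Bool → Bool → Bool → State

Finite-Marks : Finite Marks
Finite-Marks = Finite-retract (Finite-× Finite-Bool (Finite-× Finite-Bool (Finite-× Finite-Bool Finite-Bool)))
  (λ { (a , b , c , d) → marks a b c d }) (λ { (marks a b c d) → a , b , c , d }) (λ { (marks a b c d) → refl })

Finite-Cell : Finite Cell
Finite-Cell = Finite-retract
  (Finite-⊎ Finite-Bool (Finite-⊎ Finite-⊤ (Finite-⊎ Finite-Bool (Finite-⊎ (Finite-× Finite-Bool Finite-Marks)
    (Finite-⊎ Finite-Bool (Finite-× Finite-Bool (Finite-× Finite-Bool Finite-Marks)))))))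
  fromSum toSum fromSum-toSum
  where
  fromSum : Bool ⊎ ⊤ ⊎ Bool ⊎ (Bool × Marks) ⊎ Bool ⊎ (Bool × Bool × Marks) → Cell
  fromSum (inj₁ b)                                       = input b
  fromSum (inj₂ (inj₁ _))                                = header
  fromSum (inj₂ (inj₂ (inj₁ b)))                         = tally b
  fromSum (inj₂ (inj₂ (inj₂ (inj₁ (b , m)))))            = fieldEnd b m
  fromSum (inj₂ (inj₂ (inj₂ (inj₂ (inj₁ b)))))           = flag∃ b
  fromSum (inj₂ (inj₂ (inj₂ (inj₂ (inj₂ (a , b , m)))))) = blockEnd a b m
  toSum : Cell → Bool ⊎ ⊤ ⊎ Bool ⊎ (Bool × Marks) ⊎ Bool ⊎ (Bool × Bool × Marks)
  toSum (input b)        = inj₁ b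
  toSum header           = inj₂ (inj₁ tt)
  toSum (tally b)        = inj₂ (inj₂ (inj₁ b))
  toSum (fieldEnd b m)   = inj₂ (inj₂ (inj₂ (inj₁ (b , m))))
  toSum (flag∃ b)        = inj₂ (inj₂ (inj₂ (inj₂ (inj₁ b))))
  toSum (blockEnd a b m) = inj₂ (inj₂ (inj₂ (inj₂ (inj₂ (a , b , m)))))
  fromSum-toSum : ∀ c → fromSum (toSum c) ≡ c
  fromSum-toSum (input b)        = refl
  fromSum-toSum header           = refl
  fromSum-toSum (tally b)        = refl
  fromSum-toSum (fieldEnd b m)   = refl
  fromSum-toSum (flag∃ b)        = refl
  fromSum-toSum (blockEnd a b m) = refl

Finite-Phase : Finite Phase
Finite-Phase =
  Finite-retract (Finite-⊎ Finite-⊤ (Finite-⊎ Finite-⊤ (Finite-⊎ Finite-⊤ (Finite-⊎ Finite-⊤ Finite-Marks))))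
  fromSum toSum fromSum-toSum
  where
  fromSum : ⊤ ⊎ ⊤ ⊎ ⊤ ⊎ ⊤ ⊎ Marks → Phase
  fromSum (inj₁ _)                         = parse
  fromSum (inj₂ (inj₁ _))                  = reset
  fromSum (inj₂ (inj₂ (inj₁ _)))           = read
  fromSum (inj₂ (inj₂ (inj₂ (inj₁ _))))    = update
  fromSum (inj₂ (inj₂ (inj₂ (inj₂ m))))    = apply m
  toSum : Phase → ⊤ ⊎ ⊤ ⊎ ⊤ ⊎ ⊤ ⊎ Marks
  toSum parse     = inj₁ tt
  toSum reset     = inj₂ (inj₁ tt)
  toSum read      = inj₂ (inj₂ (inj₁ tt))
  toSum update    = inj₂ (inj₂ (inj₂ (inj₁ tt)))
  toSum (apply m) = inj₂ (inj₂ (inj₂ (inj₂ m)))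
  fromSum-toSum : ∀ p → fromSum (toSum p) ≡ p
  fromSum-toSum parse     = refl
  fromSum-toSum reset     = refl
  fromSum-toSum read      = refl
  fromSum-toSum update    = refl
  fromSum-toSum (apply m) = refl

Finite-ParsePos : Finite ParsePos
Finite-ParsePos = Finite-retract (Finite-Fin 8) fromFin toFin fromFin-toFin
  where
  fromFin : Fin 8 → ParsePos
  fromFin fzero                                                  = atHeader
  fromFin (fsuc fzero)                                           = atStart
  fromFin (fsuc (fsuc fzero))                                    = atBlock
  fromFin (fsuc (fsuc (fsuc fzero)))                             = inFieldA
  fromFin (fsuc (fsuc (fsuc (fsuc fzero))))                      = atFieldB
  fromFin (fsuc (fsuc (fsuc (fsuc (fsuc fzero)))))               = atFlag∃
  fromFin (fsuc (fsuc (fsuc (fsuc (fsuc (fsuc fzero))))))        = atFlag∀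
  fromFin (fsuc (fsuc (fsuc (fsuc (fsuc (fsuc (fsuc _)))))))     = malformed
  toFin : ParsePos → Fin 8
  toFin atHeader  = fzero
  toFin atStart   = fsuc fzero
  toFin atBlock   = fsuc (fsuc fzero)
  toFin inFieldA  = fsuc (fsuc (fsuc fzero))
  toFin atFieldB  = fsuc (fsuc (fsuc (fsuc fzero)))
  toFin atFlag∃   = fsuc (fsuc (fsuc (fsuc (fsuc fzero))))
  toFin atFlag∀   = fsuc (fsuc (fsuc (fsuc (fsuc (fsuc fzero)))))
  toFin malformed = fsuc (fsuc (fsuc (fsuc (fsuc (fsuc (fsuc fzero))))))
  fromFin-toFin : ∀ p → fromFin (toFin p) ≡ p
  fromFin-toFin atHeader  = refl
  fromFin-toFin atStart   = refl
  fromFin-toFin atBlock   = refl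
  fromFin-toFin inFieldA  = refl
  fromFin-toFin atFieldB  = refl
  fromFin-toFin atFlag∃   = refl
  fromFin-toFin atFlag∀   = refl
  fromFin-toFin malformed = refl

Finite-UpdatePos : Finite UpdatePos
Finite-UpdatePos = Finite-retract (Finite-Fin 3) fromFin toFin fromFin-toFin
  where
  fromFin : Fin 3 → UpdatePos
  fromFin fzero             = atStartField
  fromFin (fsuc fzero)      = atFieldA
  fromFin (fsuc (fsuc _))   = atFieldB
  toFin : UpdatePos → Fin 3
  toFin atStartField = fzero
  toFin atFieldA     = fsuc fzero
  toFin atFieldB     = fsuc (fsuc fzero)
  fromFin-toFin : ∀ p → fromFin (toFin p) ≡ p
  fromFin-toFin atStartField = refl
  fromFin-toFin atFieldA     = refl
  fromFin-toFin atFieldB     = refl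

Finite-State : Finite State
Finite-State = Finite-retract
  (Finite-⊎ Finite-ParsePos (Finite-⊎ Finite-Bool (Finite-⊎ (Finite-× Finite-Bool (Finite-× Finite-Marks Finite-Bool))
    (Finite-⊎ (Finite-× Finite-Marks Finite-Bool)
      (Finite-× Finite-UpdatePos (Finite-× Finite-Marks (Finite-× Finite-Marks
        (Finite-× Finite-Bool (Finite-× Finite-Bool Finite-Bool)))))))))
  fromSum toSum fromSum-toSum
  where
  Sum : Set
  Sum = ParsePos ⊎ Bool ⊎ (Bool × Marks × Bool) ⊎ (Marks × Bool) ⊎ (UpdatePos × Marks × Marks × Bool × Bool × Bool)
  fromSum : Sum → State
  fromSum (inj₁ p)                                            = parsing p
  fromSum (inj₂ (inj₁ b))                                     = resetting b
  fromSum (inj₂ (inj₂ (inj₁ (a , m , b))))                    = reading a m b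
  fromSum (inj₂ (inj₂ (inj₂ (inj₁ (m , b)))))                 = applying m b
  fromSum (inj₂ (inj₂ (inj₂ (inj₂ (u , x , y , a , b , c))))) = updating u x y a b c
  toSum : State → Sum
  toSum (parsing p)            = inj₁ p
  toSum (resetting b)          = inj₂ (inj₁ b)
  toSum (reading a m b)        = inj₂ (inj₂ (inj₁ (a , m , b)))
  toSum (applying m b)         = inj₂ (inj₂ (inj₂ (inj₁ (m , b))))
  toSum (updating u x y a b c) = inj₂ (inj₂ (inj₂ (inj₂ (u , x , y , a , b , c))))
  fromSum-toSum : ∀ t → fromSum (toSum t) ≡ t
  fromSum-toSum (parsing p)            = refl
  fromSum-toSum (resetting b)          = refl
  fromSum-toSum (reading a m b)        = refl
  fromSum-toSum (applying m b)         = refl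
  fromSum-toSum (updating u x y a b c) = refl

-- Input symbols get codes 0 and 1, as the machine's input convention requires.
code : Cell → Fin (2 + size Finite-Cell)
code (input false) = fzero
code (input true)  = fsuc fzero
code c             = fsuc (fsuc (index Finite-Cell c))

decode : Fin (2 + size Finite-Cell) → Cell
decode fzero           = input false
decode (fsuc fzero)    = input true
decode (fsuc (fsuc i)) = element Finite-Cell i

decode-code : ∀ c → decode (code c) ≡ c
decode-code (input false)    = refl
decode-code (input true)     = refl
decode-code header           = element-index Finite-Cell header
decode-code (tally b)        = element-index Finite-Cell (tally b)
decode-code (fieldEnd b m)   = element-index Finite-Cell (fieldEnd b m)
decode-code (flag∃ b)        = element-index Finite-Cell (flag∃ b)
decode-code (blockEnd a b m) = element-index Finite-Cell (blockEnd a b m)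

parseCell : ParsePos → Cell → State × Cell
parseCell atHeader (input true)  = parsing atHeader , header
parseCell atHeader (input false) = parsing atStart , header
parseCell atStart  (input true)  = parsing atStart , tally false
parseCell atStart  (input false) = parsing atBlock , fieldEnd false noMarks
parseCell atBlock  (input true)  = parsing inFieldA , tally false
parseCell atBlock  (input false) = parsing atFieldB , fieldEnd false noMarks
parseCell inFieldA (input true)  = parsing inFieldA , tally false
parseCell inFieldA (input false) = parsing atFieldB , fieldEnd false noMarks
parseCell atFieldB (input true)  = parsing atFieldB , tally false
parseCell atFieldB (input false) = parsing atFlag∃ , fieldEnd false noMarks
parseCell atFlag∃  (input b)     = parsing atFlag∀ , flag∃ b
parseCell atFlag∀  (input b)     = parsing atBlock , blockEnd b false noMarks
parseCell _        _             = parsing malformed , header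

-- The flag records whether the cursor has been placed (on the first block).
resetCell : Bool → Cell → State × Cell
resetCell placed (tally _)        = resetting placed , tally false
resetCell placed (fieldEnd _ _)   = resetting placed , fieldEnd false noMarks
resetCell placed (blockEnd a _ m) = resetting true , blockEnd a (not placed) m
resetCell placed c                = resetting placed , c

-- Reading the block under the cursor yields its marks and moves the cursor one block on.
readBlockEnd : Bool → Marks → Bool → Bool → Bool → Marks → State × Cell
readBlockEnd found m moveHere a true  m' = reading true m' true , blockEnd a false m'
readBlockEnd found m true     a false m' = reading found m false , blockEnd a true m'
readBlockEnd found m false    a false m' = reading found m false , blockEnd a false m'

readCell : Bool → Marks → Bool → Cell → State × Cell
readCell found m moveHere (blockEnd a c m') = readBlockEnd found m moveHere a c m'
readCell found m moveHere c                 = reading found m moveHere , c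

-- Each field counts down one tally; a field whose count is exhausted loads m.
applyTally : Marks → Bool → Bool → State × Cell
applyTally m false   false = applying m true , tally true
applyTally m true    false = applying m true , tally false
applyTally m counted true  = applying m counted , tally true

applyFieldEnd : Marks → Bool → Bool → Marks → State × Cell
applyFieldEnd m true  loaded v = applying m false , fieldEnd loaded v
applyFieldEnd m false true   v = applying m false , fieldEnd true v
applyFieldEnd m false false  v = applying m false , fieldEnd true m

applyCell : Marks → Bool → Cell → State × Cell
applyCell m counted (tally used)        = applyTally m counted used
applyCell m counted (fieldEnd loaded v) = applyFieldEnd m counted loaded v
applyCell m counted c                   = applying m counted , c

gained : Bool → Bool → Bool
gained a b = not a ∧ b

grows : Marks → Marks → Bool
grows m n =
  gained (win₀ m) (win₀ n) ∨ (gained (win₁ m) (win₁ n) ∨ (gained (win₂ m) (win₂ n) ∨ gained (win₃ m) (win₃ n)))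

-- The update sweep carries the marks loaded into the two fields of the current
-- block, its F∃ flag, whether some marks grew, and win₀ of the start field.
updateFieldEnd : UpdatePos → Marks → Marks → Bool → Bool → Bool → Bool → Marks → State × Cell
updateFieldEnd atStartField ma mb e grew answer loaded v = updating atFieldA ma mb e grew (win₀ v) , fieldEnd loaded v
updateFieldEnd atFieldA     ma mb e grew answer loaded v = updating atFieldB v mb e grew answer , fieldEnd loaded v
updateFieldEnd atFieldB     ma mb e grew answer loaded v = updating atFieldA ma v e grew answer , fieldEnd loaded v

updateCell : UpdatePos → Marks → Marks → Bool → Bool → Bool → Cell → State × Cell
updateCell u ma mb e grew answer (fieldEnd loaded v) = updateFieldEnd u ma mb e grew answer loaded v
updateCell u ma mb e grew answer (flag∃ b)           = updating u ma mb b grew answer , flag∃ b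
updateCell u ma mb e grew answer (blockEnd a c m)    =
  updating u ma mb e (grew ∨ grows m (attract e a ma mb)) answer , blockEnd a c (m ∪ᴹ attract e a ma mb)
updateCell u ma mb e grew answer c                   = updating u ma mb e grew answer , c

transduce : Phase → State → Cell → State × Cell
transduce parse     (parsing p)                     c = parseCell p c
transduce reset     (resetting placed)              c = resetCell placed c
transduce read      (reading found m moveHere)      c = readCell found m moveHere c
transduce (apply _) (applying m counted)            c = applyCell m counted c
transduce update    (updating u ma mb e grew answer) c = updateCell u ma mb e grew answer c
transduce _         t                               c = t , c

start : Phase → State
start parse     = parsing atHeader
start reset     = resetting false
start read      = reading false noMarks false
start (apply m) = applying m false
start update    = updating atStartField noMarks noMarks false false false

-- One iteration is a reset, then read and apply for every block in turn, then
-- an update; iterations repeat while some marks grow.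
next : Phase → State → Phase ⊎ Bool
next parse     (parsing atBlock)                 = inj₁ reset
next parse     _                                 = inj₂ false
next reset     _                                 = inj₁ read
next read      (reading true m _)                = inj₁ (apply m)
next read      _                                 = inj₁ update
next (apply _) _                                 = inj₁ read
next update    (updating _ _ _ _ true _)         = inj₁ reset
next update    (updating _ _ _ _ false answer)   = inj₂ answer
next update    _                                 = inj₂ false


-- Tape layouts and the effect of each phase

record Field : Set where
  constructor mkField
  field
    counted remaining : ℕ
    loaded            : Bool
    value             : Marks
open Field

fieldCells : Field → List Cell
fieldCells (mkField k j l v) = replicate k (tally true) ++ replicate j (tally false) ++ fieldEnd l v ∷ []

record Block : Set where
  constructor mkBlock
  field
    fieldA fieldB     : Field
    isF∃ isF∀ cursor : Bool
    marksOf           : Marks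
open Block

blockCells : Block → List Cell
blockCells (mkBlock a b e f c m) = fieldCells a ++ fieldCells b ++ flag∃ e ∷ blockEnd f c m ∷ []

blocksCells : List Block → List Cell
blocksCells []       = []
blocksCells (b ∷ bs) = blockCells b ++ blocksCells bs

tapeCells : ℕ → Field → List Block → List Cell
tapeCells h s bs = replicate h header ++ fieldCells s ++ blocksCells bs

record Transduces {S : Set} (f : S → Cell → S × Cell) (s : S) (xs : List Cell) (s' : S) (ys : List Cell) : Set where
  constructor transduces
  field sweep-≡ : sweep f s xs ≡ (s' , ys)

module _ {S : Set} {f : S → Cell → S × Cell} where

  tr-[] : ∀ {s} → Transduces f s [] s []
  tr-[] = transduces refl

  tr-∷ : ∀ {s s₁ s₂} c {c' cs ys} → f s c ≡ (s₁ , c') → Transduces f s₁ cs s₂ ys →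
         Transduces f s (c ∷ cs) s₂ (c' ∷ ys)
  tr-∷ c refl (transduces refl) = transduces refl

  tr-++ : ∀ {s s₁ s₂} xs {ys xs' ys'} → Transduces f s xs s₁ ys → Transduces f s₁ xs' s₂ ys' →
          Transduces f s (xs ++ xs') s₂ (ys ++ ys')
  tr-++ []       (transduces refl) t = t
  tr-++ {s} (c ∷ cs) (transduces refl) t with tr-++ {s = proj₁ (f s c)} cs (transduces refl) t
  ... | transduces e = transduces (cong (λ r → proj₁ r , proj₂ (f s c) ∷ proj₂ r) e)

  tr-replicate : ∀ {s} k c {c'} → f s c ≡ (s , c') → Transduces f s (replicate k c) s (replicate k c')
  tr-replicate zero    c e = tr-[]
  tr-replicate (suc k) c e = tr-∷ c e (tr-replicate k c e)

  tr-≡-in : ∀ {s xs xs' s' ys} → Transduces f s xs s' ys → xs ≡ xs' → Transduces f s xs' s' ys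
  tr-≡-in t refl = t

  tr-≡-out : ∀ {s xs s' ys ys'} → Transduces f s xs s' ys → ys ≡ ys' → Transduces f s xs s' ys'
  tr-≡-out t refl = t

  tr-≡-end : ∀ {s xs s' s'' ys} → Transduces f s xs s' ys → s' ≡ s'' → Transduces f s xs s'' ys
  tr-≡-end t refl = t

  tr-field : ∀ {s s'} k j l v {c₀ c₁ c} →
             f s (tally true) ≡ (s , c₁) → f s (tally false) ≡ (s , c₀) → f s (fieldEnd l v) ≡ (s' , c) →
             Transduces f s (fieldCells (mkField k j l v)) s' (replicate k c₁ ++ replicate j c₀ ++ c ∷ [])
  tr-field k j l v e₁ e₀ e =
    tr-++ (replicate k (tally true)) (tr-replicate k _ e₁)
          (tr-++ (replicate j (tally false)) (tr-replicate j _ e₀) (tr-∷ _ e tr-[]))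

replicate-++ : ∀ {A : Set} (x : A) k j (ys : List A) → replicate k x ++ replicate j x ++ ys ≡ replicate (k + j) x ++ ys
replicate-++ x zero    j ys = refl
replicate-++ x (suc k) j ys = cong (x ∷_) (replicate-++ x k j ys)

replicate-snoc : ∀ {A : Set} (x : A) k (ys : List A) → replicate k x ++ x ∷ ys ≡ x ∷ replicate k x ++ ys
replicate-snoc x zero    ys = refl
replicate-snoc x (suc k) ys = cong (x ∷_) (replicate-snoc x k ys)

setCursor : Bool → Block → Block
setCursor c (mkBlock a b e f _ m) = mkBlock a b e f c m

clearCursors : List Block → List Block
clearCursors = map (setCursor false)

cursorAt : ℕ → List Block → List Block
cursorAt _       []       = []
cursorAt zero    (b ∷ bs) = setCursor true b ∷ clearCursors bs
cursorAt (suc i) (b ∷ bs) = setCursor false b ∷ cursorAt i bs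

resetField : Field → Field
resetField (mkField k j l v) = mkField 0 (k + j) false noMarks

resetBlock : Block → Block
resetBlock (mkBlock a b e f c m) = mkBlock (resetField a) (resetField b) e f c m

reset-field : ∀ placed F →
  Transduces (transduce reset) (resetting placed) (fieldCells F) (resetting placed) (fieldCells (resetField F))
reset-field placed (mkField k j l v) = tr-≡-out (tr-field k j l v refl refl refl) (replicate-++ (tally false) k j _)

reset-block : ∀ placed b → Transduces (transduce reset) (resetting placed) (blockCells b) (resetting true)
                                       (blockCells (setCursor (not placed) (resetBlock b)))
reset-block placed (mkBlock a b e f c m) =
  tr-++ (fieldCells a) (reset-field placed a) (tr-++ (fieldCells b) (reset-field placed b) (tr-∷ _ refl (tr-∷ _ refl tr-[])))

reset-blocks-placed : ∀ bs → Transduces (transduce reset) (resetting true) (blocksCells bs) (resetting true)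
                                         (blocksCells (clearCursors (map resetBlock bs)))
reset-blocks-placed []       = tr-[]
reset-blocks-placed (b ∷ bs) = tr-++ (blockCells b) (reset-block true b) (reset-blocks-placed bs)

reset-blocks : ∀ bs →
  ∃[ s ] Transduces (transduce reset) (resetting false) (blocksCells bs) s (blocksCells (cursorAt 0 (map resetBlock bs)))
reset-blocks []       = _ , tr-[]
reset-blocks (b ∷ bs) = _ , tr-++ (blockCells b) (reset-block false b) (reset-blocks-placed bs)

reset-tape : ∀ h q bs → ∃[ s ] Transduces (transduce reset) (start reset) (tapeCells h q bs) s
                                           (tapeCells h (resetField q) (cursorAt 0 (map resetBlock bs)))
reset-tape h q bs =
  _ , tr-++ (replicate h header) (tr-replicate h header refl)
            (tr-++ (fieldCells q) (reset-field false q) (proj₂ (reset-blocks bs)))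

afterRead : Maybe Marks → Phase ⊎ Bool
afterRead (just m) = inj₁ (apply m)
afterRead nothing  = inj₁ update

read-field : ∀ found m moveHere F →
  Transduces (transduce read) (reading found m moveHere) (fieldCells F) (reading found m moveHere) (fieldCells F)
read-field found m moveHere (mkField k j l v) = tr-field k j l v refl refl refl

read-block : ∀ {found m moveHere found' m' moveHere' c c'} b →
  readBlockEnd found m moveHere (isF∀ b) c (marksOf b) ≡ (reading found' m' moveHere' , blockEnd (isF∀ b) c' (marksOf b)) →
  Transduces (transduce read) (reading found m moveHere) (blockCells (setCursor c b))
                              (reading found' m' moveHere') (blockCells (setCursor c' b))
read-block {found} {m} {moveHere} (mkBlock a b e f _ m') end =
  tr-++ (fieldCells a) (read-field found m moveHere a)
        (tr-++ (fieldCells b) (read-field found m moveHere b) (tr-∷ _ refl (tr-∷ _ end tr-[])))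

read-blocks-idle : ∀ found m bs → Transduces (transduce read) (reading found m false) (blocksCells (clearCursors bs))
                                                (reading found m false) (blocksCells (clearCursors bs))
read-blocks-idle found m []       = tr-[]
read-blocks-idle found m (b ∷ bs) = tr-++ (blockCells (setCursor false b)) (read-block b refl) (read-blocks-idle found m bs)

read-blocks-after : ∀ m bs → ∃[ moveHere ] Transduces (transduce read) (reading true m true) (blocksCells (clearCursors bs))
                                                       (reading true m moveHere) (blocksCells (cursorAt 0 bs))
read-blocks-after m []       = true , tr-[]
read-blocks-after m (b ∷ bs) = false , tr-++ (blockCells (setCursor false b)) (read-block b refl) (read-blocks-idle true m bs)

read-blocks : ∀ i bs →
  ∃[ s ] Transduces (transduce read) (start read) (blocksCells (cursorAt i bs)) s (blocksCells (cursorAt (suc i) bs))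
                            × next read s ≡ afterRead (head (drop i (map marksOf bs)))
read-blocks zero    []       = _ , tr-[] , refl
read-blocks (suc i) []       = _ , tr-[] , refl
read-blocks zero    (b ∷ bs) =
  _ , tr-++ (blockCells (setCursor true b)) (read-block b refl) (proj₂ (read-blocks-after (marksOf b) bs)) , refl
read-blocks (suc i) (b ∷ bs) with read-blocks i bs
... | s , t , e = s , tr-++ (blockCells (setCursor false b)) (read-block b refl) t , e

read-tape : ∀ h q i bs →
  ∃[ s ] Transduces (transduce read) (start read) (tapeCells h q (cursorAt i bs)) s (tapeCells h q (cursorAt (suc i) bs))
                              × next read s ≡ afterRead (head (drop i (map marksOf bs)))
read-tape h q i bs with read-blocks i bs
... | s , t , e =
  s , tr-++ (replicate h header) (tr-replicate h header refl) (tr-++ (fieldCells q) (read-field false noMarks false q) t) , e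

applyField : Marks → Field → Field
applyField m (mkField k (suc j) l v) = mkField (suc k) j l v
applyField m (mkField k zero true v)  = mkField k zero true v
applyField m (mkField k zero false v) = mkField k zero true m

applyBlock : Marks → Block → Block
applyBlock m (mkBlock a b e f c m') = mkBlock (applyField m a) (applyField m b) e f c m'

apply-field : ∀ m F →
  Transduces (transduce (apply m)) (applying m false) (fieldCells F) (applying m false) (fieldCells (applyField m F))
apply-field m (mkField k (suc j) l v) =
  tr-≡-out (tr-++ (replicate k (tally true)) (tr-replicate k (tally true) refl)
             (tr-∷ _ refl (tr-++ (replicate j (tally false)) (tr-replicate j (tally false) refl) (tr-∷ _ refl tr-[]))))
           (replicate-snoc (tally true) k _)
apply-field m (mkField k zero true v)  = tr-++ (replicate k (tally true)) (tr-replicate k (tally true) refl) (tr-∷ _ refl tr-[])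
apply-field m (mkField k zero false v) = tr-++ (replicate k (tally true)) (tr-replicate k (tally true) refl) (tr-∷ _ refl tr-[])

apply-block : ∀ m b →
  Transduces (transduce (apply m)) (applying m false) (blockCells b) (applying m false) (blockCells (applyBlock m b))
apply-block m (mkBlock a b e f c m') =
  tr-++ (fieldCells a) (apply-field m a) (tr-++ (fieldCells b) (apply-field m b) (tr-∷ _ refl (tr-∷ _ refl tr-[])))

apply-blocks : ∀ m bs →
  Transduces (transduce (apply m)) (applying m false) (blocksCells bs) (applying m false) (blocksCells (map (applyBlock m) bs))
apply-blocks m []       = tr-[]
apply-blocks m (b ∷ bs) = tr-++ (blockCells b) (apply-block m b) (apply-blocks m bs)

apply-tape : ∀ m h q bs → Transduces (transduce (apply m)) (start (apply m)) (tapeCells h q bs) (applying m false)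
                                      (tapeCells h (applyField m q) (map (applyBlock m) bs))
apply-tape m h q bs =
  tr-++ (replicate h header) (tr-replicate h header refl) (tr-++ (fieldCells q) (apply-field m q) (apply-blocks m bs))

applyBlock-setCursor : ∀ m c b → applyBlock m (setCursor c b) ≡ setCursor c (applyBlock m b)
applyBlock-setCursor m c (mkBlock a b e f c' m') = refl

applyBlock-clearCursors : ∀ m bs → map (applyBlock m) (clearCursors bs) ≡ clearCursors (map (applyBlock m) bs)
applyBlock-clearCursors m []       = refl
applyBlock-clearCursors m (b ∷ bs) = cong₂ _∷_ (applyBlock-setCursor m false b) (applyBlock-clearCursors m bs)

applyBlock-cursorAt : ∀ m i bs → map (applyBlock m) (cursorAt i bs) ≡ cursorAt i (map (applyBlock m) bs)
applyBlock-cursorAt m i       []       = refl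
applyBlock-cursorAt m zero    (b ∷ bs) = cong₂ _∷_ (applyBlock-setCursor m true b) (applyBlock-clearCursors m bs)
applyBlock-cursorAt m (suc i) (b ∷ bs) = cong₂ _∷_ (applyBlock-setCursor m false b) (applyBlock-cursorAt m i bs)

updateBlock : Block → Block
updateBlock (mkBlock a b e f c m) = mkBlock a b e f c (m ∪ᴹ attract e f (value a) (value b))

blockGrows : Block → Bool
blockGrows (mkBlock a b e f c m) = grows m (attract e f (value a) (value b))

anyGrows : List Block → Bool
anyGrows []       = false
anyGrows (b ∷ bs) = blockGrows b ∨ anyGrows bs

update-field : ∀ u ma mb e grew answer F →
  Transduces (transduce update) (updating u ma mb e grew answer) (fieldCells F)
             (proj₁ (updateFieldEnd u ma mb e grew answer (loaded F) (value F))) (fieldCells F)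
update-field u ma mb e grew answer (mkField k j l v) = tr-field k j l v refl refl (fieldEnd-unchanged u)
  where
  fieldEnd-unchanged : ∀ u → transduce update (updating u ma mb e grew answer) (fieldEnd l v)
                             ≡ (proj₁ (updateFieldEnd u ma mb e grew answer l v) , fieldEnd l v)
  fieldEnd-unchanged atStartField = refl
  fieldEnd-unchanged atFieldA     = refl
  fieldEnd-unchanged atFieldB     = refl

update-block : ∀ ma mb e grew answer b → ∃[ ma' ] ∃[ mb' ] ∃[ e' ]
  Transduces (transduce update) (updating atFieldA ma mb e grew answer) (blockCells b)
             (updating atFieldA ma' mb' e' (grew ∨ blockGrows b) answer) (blockCells (updateBlock b))
update-block ma mb e grew answer (mkBlock a b e₁ f c m) = _ , _ , _ ,
  tr-++ (fieldCells a) (update-field atFieldA ma mb e grew answer a)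
        (tr-++ (fieldCells b) (update-field atFieldB (value a) mb e grew answer b) (tr-∷ _ refl (tr-∷ _ refl tr-[])))

update-blocks : ∀ bs ma mb e grew answer → ∃[ ma' ] ∃[ mb' ] ∃[ e' ]
  Transduces (transduce update) (updating atFieldA ma mb e grew answer) (blocksCells bs)
             (updating atFieldA ma' mb' e' (grew ∨ anyGrows bs) answer) (blocksCells (map updateBlock bs))
update-blocks [] ma mb e grew answer =
  ma , mb , e , tr-≡-end tr-[] (cong (λ g → updating atFieldA ma mb e g answer) (sym (∨-identityʳ grew)))
update-blocks (b ∷ bs) ma mb e grew answer with update-block ma mb e grew answer b
... | ma₁ , mb₁ , e₁ , t₁ with update-blocks bs ma₁ mb₁ e₁ (grew ∨ blockGrows b) answer
... | ma₂ , mb₂ , e₂ , t₂ = ma₂ , mb₂ , e₂ , tr-≡-end (tr-++ (blockCells b) t₁ t₂)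
      (cong (λ g → updating atFieldA ma₂ mb₂ e₂ g answer) (∨-assoc grew (blockGrows b) (anyGrows bs)))

next-update : ∀ ma mb e grew answer →
  next update (updating atFieldA ma mb e grew answer) ≡ (if grew then inj₁ reset else inj₂ answer)
next-update ma mb e true  answer = refl
next-update ma mb e false answer = refl

update-tape : ∀ h q bs →
  ∃[ s ] Transduces (transduce update) (start update) (tapeCells h q bs) s (tapeCells h q (map updateBlock bs))
                              × next update s ≡ (if anyGrows bs then inj₁ reset else inj₂ (win₀ (value q)))
update-tape h q bs with update-blocks bs noMarks noMarks false false (win₀ (value q))
... | ma , mb , e , t =
  _ , tr-++ (replicate h header) (tr-replicate h header refl)
            (tr-++ (fieldCells q) (update-field atStartField noMarks noMarks false false false q) t) ,
  next-update ma mb e (anyGrows bs) (win₀ (value q))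

open SweepMachine (size Finite-Cell) Cell code decode decode-code input refl refl
                  Phase State Finite-Phase Finite-State transduce start next parse

-- Iterating to the fixpoint

sweeps-continue : ∀ {p Y s Y' p' b} → Transduces (transduce p) (start p) Y s Y' → next p s ≡ inj₁ p' →
                  Sweeps p' Y' b → Sweeps p Y b
sweeps-continue (transduces refl) n r = continues n r

sweeps-halt : ∀ {p Y s Y' b} → Transduces (transduce p) (start p) Y s Y' → next p s ≡ inj₂ b → Sweeps p Y b
sweeps-halt (transduces refl) n = halts n

applyAll : List Marks → Field → Field
applyAll []       F = F
applyAll (m ∷ ms) F = applyAll ms (applyField m F)

applyAllBlock : List Marks → Block → Block
applyAllBlock ms (mkBlock a b e f c m) = mkBlock (applyAll ms a) (applyAll ms b) e f c m

drop-suc : ∀ {A : Set} i (xs : List A) {y ys} → drop i xs ≡ y ∷ ys → drop (suc i) xs ≡ ys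
drop-suc zero    (x ∷ xs) refl = refl
drop-suc (suc i) (x ∷ xs) e    = drop-suc i xs e

cursorAt-beyond : ∀ i bs → drop i (map marksOf bs) ≡ [] → cursorAt (suc i) bs ≡ clearCursors bs
cursorAt-beyond zero    []       _ = refl
cursorAt-beyond (suc i) []       _ = refl
cursorAt-beyond (suc i) (b ∷ bs) e = cong (setCursor false b ∷_) (cursorAt-beyond i bs e)

-- Reading block i and applying its marks, for i = 0, 1, …: a field pointing to
-- block p has then counted down to zero exactly when the marks of block p arrive.
read-apply-loop : ∀ h i q bs rest {b} → drop i (map marksOf bs) ≡ rest →
  Sweeps update (tapeCells h (applyAll rest q) (clearCursors (map (applyAllBlock rest) bs))) b →
  Sweeps read (tapeCells h q (cursorAt i bs)) b
read-apply-loop h i q bs [] {b} d r with read-tape h q i bs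
... | s , t , n = sweeps-continue t (trans n (cong (afterRead ∘ head) d))
                    (subst (λ bs' → Sweeps update (tapeCells h q bs') b) cleared r)
  where
  cleared : clearCursors (map (applyAllBlock []) bs) ≡ cursorAt (suc i) bs
  cleared = trans (cong clearCursors (map-id bs)) (sym (cursorAt-beyond i bs d))
read-apply-loop h i q bs (m ∷ rest) {b} d r with read-tape h q i bs
... | s , t , n =
  sweeps-continue t (trans n (cong (afterRead ∘ head) d))
    (sweeps-continue (tr-≡-out (apply-tape m h q (cursorAt (suc i) bs))
                               (cong (tapeCells h (applyField m q)) (applyBlock-cursorAt m (suc i) bs)))
                     refl
      (read-apply-loop h (suc i) (applyField m q) (map (applyBlock m) bs) rest
         (trans (cong (drop (suc i)) (sym (map-∘ bs))) (drop-suc i _ d))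
         (subst (λ bs' → Sweeps update (tapeCells h (applyAll rest (applyField m q)) (clearCursors bs')) b) (map-∘ bs) r)))

-- The game graph that a list of blocks describes, with states numbered by position.
record Node : Set where
  constructor node
  field
    next₀ next₁   : ℕ
    final∃ final∀ : Bool

pointer : Field → ℕ
pointer F = counted F + remaining F

nodeOf : Block → Node
nodeOf b = node (pointer (fieldA b)) (pointer (fieldB b)) (isF∃ b) (isF∀ b)

lookupMarks : List Marks → ℕ → Marks
lookupMarks []       _       = noMarks
lookupMarks (m ∷ ms) zero    = m
lookupMarks (m ∷ ms) (suc i) = lookupMarks ms i

attractAt : List Marks → Node → Marks → Marks
attractAt ms (node a b e f) m = m ∪ᴹ attract e f (lookupMarks ms a) (lookupMarks ms b)

marksStep : List Node → List Marks → List Marks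
marksStep ns ms = zipWith (attractAt ms) ns ms

loadField : List Marks → Field → Field
loadField ms F = applyAll ms (resetField F)

loadBlock : List Marks → Block → Block
loadBlock ms b = setCursor false (applyAllBlock ms (resetBlock b))

applyAll-loaded : ∀ ms k v → applyAll ms (mkField k 0 true v) ≡ mkField k 0 true v
applyAll-loaded []       k v = refl
applyAll-loaded (m ∷ ms) k v = applyAll-loaded ms k v

value-applyAll : ∀ ms k p → value (applyAll ms (mkField k p false noMarks)) ≡ lookupMarks ms p
value-applyAll []       k p       = refl
value-applyAll (m ∷ ms) k zero    = cong value (applyAll-loaded ms k m)
value-applyAll (m ∷ ms) k (suc p) = value-applyAll ms (suc k) p

pointer-applyField : ∀ m F → pointer (applyField m F) ≡ pointer F
pointer-applyField m (mkField k (suc j) l v) = sym (+-suc k j)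
pointer-applyField m (mkField k zero true v)  = refl
pointer-applyField m (mkField k zero false v) = refl

pointer-applyAll : ∀ ms F → pointer (applyAll ms F) ≡ pointer F
pointer-applyAll []       F = refl
pointer-applyAll (m ∷ ms) F = trans (pointer-applyAll ms (applyField m F)) (pointer-applyField m F)

value-loadField : ∀ ms F → value (loadField ms F) ≡ lookupMarks ms (pointer F)
value-loadField ms F = value-applyAll ms 0 (pointer F)

pointer-loadField : ∀ ms F → pointer (loadField ms F) ≡ pointer F
pointer-loadField ms F = pointer-applyAll ms (resetField F)

zipWith-map : ∀ {A B C D : Set} (g : B → C → D) (f₁ : A → B) (f₂ : A → C) xs →
              zipWith g (map f₁ xs) (map f₂ xs) ≡ map (λ x → g (f₁ x) (f₂ x)) xs
zipWith-map g f₁ f₂ []       = refl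
zipWith-map g f₁ f₂ (x ∷ xs) = cong (g (f₁ x) (f₂ x) ∷_) (zipWith-map g f₁ f₂ xs)

nodes-iteration : ∀ ms bs → map nodeOf (map updateBlock (map (loadBlock ms) bs)) ≡ map nodeOf bs
nodes-iteration ms bs = trans (sym (trans (map-∘ bs) (map-∘ (map (loadBlock ms) bs))))
  (map-cong (λ b → cong₂ (λ a a' → node a a' (isF∃ b) (isF∀ b))
                         (pointer-loadField ms (fieldA b)) (pointer-loadField ms (fieldB b))) bs)

marks-iteration : ∀ bs → map marksOf (map updateBlock (map (loadBlock (map marksOf bs)) bs))
                         ≡ marksStep (map nodeOf bs) (map marksOf bs)
marks-iteration bs = trans (sym (trans (map-∘ bs) (map-∘ (map (loadBlock ms) bs))))
  (trans (map-cong (λ b → cong₂ (λ x y → marksOf b ∪ᴹ attract (isF∃ b) (isF∀ b) x y)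
                               (value-loadField ms (fieldA b)) (value-loadField ms (fieldB b))) bs)
         (sym (zipWith-map (attractAt ms) nodeOf marksOf bs)))
  where
  ms = map marksOf bs

one-iteration : ∀ h q bs {b} →
  Sweeps update (tapeCells h (loadField (map marksOf bs) q) (map (loadBlock (map marksOf bs)) bs)) b →
  Sweeps reset (tapeCells h q bs) b
one-iteration h q bs {b} r with reset-tape h q bs
... | s , t = sweeps-continue t refl (read-apply-loop h 0 (resetField q) (map resetBlock bs) ms (sym (map-∘ bs))
                (subst (λ bs' → Sweeps update (tapeCells h (loadField ms q) bs') b) loadBlocks r))
  where
  ms = map marksOf bs
  loadBlocks : map (loadBlock ms) bs ≡ clearCursors (map (applyAllBlock ms) (map resetBlock bs))
  loadBlocks = trans (map-∘ bs) (map-∘ (map resetBlock bs))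

bit : Bool → ℕ
bit true  = 1
bit false = 0

unmarkedBit : Bool → ℕ
unmarkedBit true  = 0
unmarkedBit false = 1

unmarked : Marks → ℕ
unmarked (marks a b c d) = unmarkedBit a + (unmarkedBit b + (unmarkedBit c + unmarkedBit d))

unmarkedCount : List Marks → ℕ
unmarkedCount ms = sum (map unmarked ms)

unmarkedBit-∨ : ∀ a c → unmarkedBit (a ∨ c) + bit (gained a c) ≡ unmarkedBit a
unmarkedBit-∨ true  c     = refl
unmarkedBit-∨ false true  = refl
unmarkedBit-∨ false false = refl

bit-∨ : ∀ x y → bit (x ∨ y) ≤ bit x + bit y
bit-∨ true  y = s≤s z≤n
bit-∨ false y = ≤-refl

unmarked-∪ᴹ : ∀ m n → bit (grows m n) + unmarked (m ∪ᴹ n) ≤ unmarked m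
unmarked-∪ᴹ (marks a b c d) (marks a' b' c' d') = begin
  bit (g₀ ∨ (g₁ ∨ (g₂ ∨ g₃))) + (u₀ + (u₁ + (u₂ + u₃)))
    ≤⟨ +-monoˡ-≤ (u₀ + (u₁ + (u₂ + u₃)))
         (≤-trans (bit-∨ g₀ _)
           (+-monoʳ-≤ (bit g₀) (≤-trans (bit-∨ g₁ _) (+-monoʳ-≤ (bit g₁) (bit-∨ g₂ g₃))))) ⟩
  (bit g₀ + (bit g₁ + (bit g₂ + bit g₃))) + (u₀ + (u₁ + (u₂ + u₃)))
    ≡⟨ interleave (bit g₀) (bit g₁) (bit g₂) (bit g₃) u₀ u₁ u₂ u₃ ⟩
  (u₀ + bit g₀) + ((u₁ + bit g₁) + ((u₂ + bit g₂) + (u₃ + bit g₃)))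
    ≡⟨ cong₂ _+_ (unmarkedBit-∨ a a')
         (cong₂ _+_ (unmarkedBit-∨ b b') (cong₂ _+_ (unmarkedBit-∨ c c') (unmarkedBit-∨ d d'))) ⟩
  unmarkedBit a + (unmarkedBit b + (unmarkedBit c + unmarkedBit d)) ∎
  where
  open ≤-Reasoning
  u₀ = unmarkedBit (a ∨ a')
  u₁ = unmarkedBit (b ∨ b')
  u₂ = unmarkedBit (c ∨ c')
  u₃ = unmarkedBit (d ∨ d')
  g₀ = gained a a'
  g₁ = gained b b'
  g₂ = gained c c'
  g₃ = gained d d'
  interleave : ∀ p q r s p' q' r' s' →
               (p + (q + (r + s))) + (p' + (q' + (r' + s'))) ≡ (p' + p) + ((q' + q) + ((r' + r) + (s' + s)))
  interleave = solve-∀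

unmarkedCount-update : ∀ bs →
  bit (anyGrows bs) + unmarkedCount (map marksOf (map updateBlock bs)) ≤ unmarkedCount (map marksOf bs)
unmarkedCount-update []                        = z≤n
unmarkedCount-update (mkBlock a b e f c m ∷ bs) = begin
  bit (g ∨ anyGrows bs) + (u + U)        ≤⟨ +-monoˡ-≤ (u + U) (bit-∨ g (anyGrows bs)) ⟩
  (bit g + bit (anyGrows bs)) + (u + U)  ≡⟨ swap-middle (bit g) (bit (anyGrows bs)) u U ⟩
  (bit g + u) + (bit (anyGrows bs) + U)  ≤⟨ +-mono-≤ (unmarked-∪ᴹ m n) (unmarkedCount-update bs) ⟩
  unmarked m + unmarkedCount (map marksOf bs) ∎
  where
  open ≤-Reasoning
  n = attract e f (value a) (value b)
  u = unmarked (m ∪ᴹ n)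
  U = unmarkedCount (map marksOf (map updateBlock bs))
  g = grows m n
  swap-middle : ∀ p q r s → (p + q) + (r + s) ≡ (p + r) + (q + s)
  swap-middle = solve-∀

unmarkedCount-grows : ∀ bs → anyGrows bs ≡ true →
  unmarkedCount (map marksOf (map updateBlock bs)) < unmarkedCount (map marksOf bs)
unmarkedCount-grows bs grew =
  subst (λ g → bit g + unmarkedCount (map marksOf (map updateBlock bs)) ≤ unmarkedCount (map marksOf bs))
        grew (unmarkedCount-update bs)

∨-false : ∀ x {y} → x ∨ y ≡ false → x ≡ false × y ≡ false
∨-false false e = refl , e

not-gained : ∀ a c → gained a c ≡ false → a ∨ c ≡ a
not-gained true  c     e = refl
not-gained false false e = refl

∪ᴹ-not-grows : ∀ m n → grows m n ≡ false → m ∪ᴹ n ≡ m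
∪ᴹ-not-grows (marks a b c d) (marks a' b' c' d') e with ∨-false (gained a a') e
... | e₀ , e' with ∨-false (gained b b') e'
... | e₁ , e'' with ∨-false (gained c c') e''
... | e₂ , e₃ rewrite not-gained a a' e₀ | not-gained b b' e₁ | not-gained c c' e₂ | not-gained d d' e₃ = refl

update-not-grows : ∀ bs → anyGrows bs ≡ false → map marksOf (map updateBlock bs) ≡ map marksOf bs
update-not-grows []                         e = refl
update-not-grows (mkBlock a b e₁ f c m ∷ bs) e with ∨-false (grows m (attract e₁ f (value a) (value b))) e
... | e₀ , e' = cong₂ _∷_ (∪ᴹ-not-grows m _ e₀) (update-not-grows bs e')

Stable : List Node → List Marks → Set
Stable ns ms = marksStep ns ms ≡ ms

FixpointAnswer : List Node → List Marks → ℕ → Bool → Set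
FixpointAnswer ns ms p b = ∃[ K ] b ≡ win₀ (lookupMarks (iter (marksStep ns) K ms) p) × Stable ns (iter (marksStep ns) K ms)

iter-shift : ∀ {A : Set} (f : A → A) n a → iter f n (f a) ≡ iter f (suc n) a
iter-shift f zero    a = refl
iter-shift f (suc n) a = cong f (iter-shift f n a)

fixpointAnswer-step : ∀ {ns ms p b} → FixpointAnswer ns (marksStep ns ms) p b → FixpointAnswer ns ms p b
fixpointAnswer-step {ns} {ms} {p} (K , answer , stable) =
  suc K , subst (λ ms' → _ ≡ win₀ (lookupMarks ms' p)) shifted answer , subst (Stable ns) shifted stable
  where
  shifted = iter-shift (marksStep ns) K ms

fixpointAnswer-cong : ∀ {ns ns' ms ms' p p' b} → ns ≡ ns' → ms ≡ ms' → p ≡ p' →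
                      FixpointAnswer ns ms p b → FixpointAnswer ns' ms' p' b
fixpointAnswer-cong refl refl refl a = a

-- Iterations run until no marks grow; each growing iteration lowers the count of
-- missing marks, which bounds the recursion.
iterate-sweeps : ∀ N h q bs → unmarkedCount (map marksOf bs) ≤ N →
  ∃[ b ] Sweeps reset (tapeCells h q bs) b × FixpointAnswer (map nodeOf bs) (map marksOf bs) (pointer q) b
iterate-sweeps N h q bs bound with update-tape h (loadField (map marksOf bs) q) (map (loadBlock (map marksOf bs)) bs)
... | s , t , n with anyGrows (map (loadBlock (map marksOf bs)) bs) in grew
... | false = _ , one-iteration h q bs (sweeps-halt t n) , 0 , cong win₀ (value-loadField ms q) , stable
  where
  ms = map marksOf bs
  stable : Stable (map nodeOf bs) ms
  stable = trans (sym (marks-iteration bs)) (trans (update-not-grows (map (loadBlock ms) bs) grew) (sym (map-∘ bs)))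
... | true = recurse N decreased
  where
  ms = map marksOf bs
  bs′ = map updateBlock (map (loadBlock ms) bs)
  decreased : unmarkedCount (map marksOf bs′) < N
  decreased = begin-strict
    unmarkedCount (map marksOf bs′)                       <⟨ unmarkedCount-grows (map (loadBlock ms) bs) grew ⟩
    unmarkedCount (map marksOf (map (loadBlock ms) bs))   ≡⟨ cong unmarkedCount (map-∘ bs) ⟨
    unmarkedCount ms                                      ≤⟨ bound ⟩
    N                                                     ∎
    where open ≤-Reasoning
  recurse : ∀ N → unmarkedCount (map marksOf bs′) < N →
    ∃[ b ] Sweeps reset (tapeCells h q bs) b × FixpointAnswer (map nodeOf bs) ms (pointer q) b
  recurse (suc N′) (s≤s bound′) with iterate-sweeps N′ h (loadField ms q) bs′ bound′
  ... | b , sweeps , answer =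
    b , one-iteration h q bs (sweeps-continue t n sweeps) ,
    fixpointAnswer-step (fixpointAnswer-cong (nodes-iteration ms bs) (marks-iteration bs) (pointer-loadField ms q) answer)

-- Parsing, and the encoding of a game DFA

untallied : ℕ → List Cell
untallied k = replicate k (tally false)

emptyEnd : Cell
emptyEnd = fieldEnd false noMarks

-- The output of the parse sweep from position p, when the whole sweep ends at a block boundary.
Parsed : ParsePos → List Cell → Set
Parsed atHeader ys = ∃[ h ] ∃[ k ] ∃[ bs ] ys ≡ header ∷ replicate h header ++ untallied k ++ emptyEnd ∷ blocksCells bs
Parsed atStart  ys = ∃[ k ] ∃[ bs ] ys ≡ untallied k ++ emptyEnd ∷ blocksCells bs
Parsed atBlock  ys = ∃[ bs ] ys ≡ blocksCells bs
Parsed inFieldA ys = ∃[ ka ] ∃[ kb ] ∃[ e ] ∃[ f ] ∃[ bs ]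
                       ys ≡ untallied ka ++ emptyEnd ∷ untallied kb ++ emptyEnd ∷
                            flag∃ e ∷ blockEnd f false noMarks ∷ blocksCells bs
Parsed atFieldB ys = ∃[ kb ] ∃[ e ] ∃[ f ] ∃[ bs ]
                       ys ≡ untallied kb ++ emptyEnd ∷ flag∃ e ∷ blockEnd f false noMarks ∷ blocksCells bs
Parsed atFlag∃  ys = ∃[ e ] ∃[ f ] ∃[ bs ] ys ≡ flag∃ e ∷ blockEnd f false noMarks ∷ blocksCells bs
Parsed atFlag∀  ys = ∃[ f ] ∃[ bs ] ys ≡ blockEnd f false noMarks ∷ blocksCells bs
Parsed malformed ys = ⊥

parsedBlock : ℕ → ℕ → Bool → Bool → Block
parsedBlock ka kb e f = mkBlock (mkField 0 ka false noMarks) (mkField 0 kb false noMarks) e f false noMarks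

blockCells-parsed : ∀ ka kb e f bs → blocksCells (parsedBlock ka kb e f ∷ bs)
  ≡ untallied ka ++ emptyEnd ∷ untallied kb ++ emptyEnd ∷ flag∃ e ∷ blockEnd f false noMarks ∷ blocksCells bs
blockCells-parsed ka kb e f bs = begin
  ((untallied ka ++ emptyEnd ∷ []) ++ (untallied kb ++ emptyEnd ∷ []) ++ rest) ++ blocksCells bs
    ≡⟨ ++-assoc (untallied ka ++ emptyEnd ∷ []) _ (blocksCells bs) ⟩
  (untallied ka ++ emptyEnd ∷ []) ++ ((untallied kb ++ emptyEnd ∷ []) ++ rest) ++ blocksCells bs
    ≡⟨ ++-assoc (untallied ka) (emptyEnd ∷ []) _ ⟩
  untallied ka ++ emptyEnd ∷ ((untallied kb ++ emptyEnd ∷ []) ++ rest) ++ blocksCells bs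
    ≡⟨ cong (λ x → untallied ka ++ emptyEnd ∷ x) (++-assoc (untallied kb ++ emptyEnd ∷ []) rest (blocksCells bs)) ⟩
  untallied ka ++ emptyEnd ∷ (untallied kb ++ emptyEnd ∷ []) ++ rest ++ blocksCells bs
    ≡⟨ cong (λ x → untallied ka ++ emptyEnd ∷ x) (++-assoc (untallied kb) (emptyEnd ∷ []) _) ⟩
  untallied ka ++ emptyEnd ∷ untallied kb ++ emptyEnd ∷ flag∃ e ∷ blockEnd f false noMarks ∷ blocksCells bs ∎
  where
  open ≡-Reasoning
  rest = flag∃ e ∷ blockEnd f false noMarks ∷ []

ParsesFrom : List Bool → ParsePos → Set
ParsesFrom xs p = proj₁ (sweep (transduce parse) (parsing p) (map input xs)) ≡ parsing atBlock →
                  Parsed p (proj₂ (sweep (transduce parse) (parsing p) (map input xs)))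

parses : ∀ xs p → ParsesFrom xs p
parses []           atBlock e = [] , refl
parses (true ∷ xs)  atHeader e with parses xs atHeader e
... | h , k , bs , eq = suc h , k , bs , cong (header ∷_) eq
parses (false ∷ xs) atHeader e with parses xs atStart e
... | k , bs , eq = 0 , k , bs , cong (header ∷_) eq
parses (true ∷ xs)  atStart e with parses xs atStart e
... | k , bs , eq = suc k , bs , cong (tally false ∷_) eq
parses (false ∷ xs) atStart e with parses xs atBlock e
... | bs , eq = 0 , bs , cong (emptyEnd ∷_) eq
parses (true ∷ xs)  atBlock e with parses xs inFieldA e
... | ka , kb , e' , f , bs , eq =
  parsedBlock (suc ka) kb e' f ∷ bs , trans (cong (tally false ∷_) eq) (sym (blockCells-parsed (suc ka) kb e' f bs))
parses (false ∷ xs) atBlock e with parses xs atFieldB e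
... | kb , e' , f , bs , eq =
  parsedBlock 0 kb e' f ∷ bs , trans (cong (emptyEnd ∷_) eq) (sym (blockCells-parsed 0 kb e' f bs))
parses (true ∷ xs)  inFieldA e with parses xs inFieldA e
... | ka , kb , e' , f , bs , eq = suc ka , kb , e' , f , bs , cong (tally false ∷_) eq
parses (false ∷ xs) inFieldA e with parses xs atFieldB e
... | kb , e' , f , bs , eq = 0 , kb , e' , f , bs , cong (emptyEnd ∷_) eq
parses (true ∷ xs)  atFieldB e with parses xs atFieldB e
... | kb , e' , f , bs , eq = suc kb , e' , f , bs , cong (tally false ∷_) eq
parses (false ∷ xs) atFieldB e with parses xs atFlag∃ e
... | e' , f , bs , eq = 0 , e' , f , bs , cong (emptyEnd ∷_) eq
parses (x ∷ xs)     atFlag∃ e with parses xs atFlag∀ e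
... | f , bs , eq = x , f , bs , cong (flag∃ x ∷_) eq
parses (x ∷ xs)     atFlag∀ e with parses xs atBlock e
... | bs , eq = x , bs , cong (blockEnd x false noMarks ∷_) eq
parses (x ∷ xs)     malformed e with parses xs malformed e
... | ()

parsed-tape : ∀ {ys} → Parsed atHeader ys → ∃[ h ] ∃[ q ] ∃[ bs ] ys ≡ tapeCells h q bs
parsed-tape (h , k , bs , eq) =
  suc h , mkField 0 k false noMarks , bs ,
  trans eq (cong (λ x → header ∷ replicate h header ++ x) (sym (++-assoc (untallied k) (emptyEnd ∷ []) (blocksCells bs))))

parse-outcome : ∀ s → s ≡ parsing atBlock ⊎ next parse s ≡ inj₂ false
parse-outcome (parsing atBlock)  = inj₁ refl
parse-outcome (parsing atHeader) = inj₂ refl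
parse-outcome (parsing atStart)  = inj₂ refl
parse-outcome (parsing inFieldA) = inj₂ refl
parse-outcome (parsing atFieldB) = inj₂ refl
parse-outcome (parsing atFlag∃)  = inj₂ refl
parse-outcome (parsing atFlag∀)  = inj₂ refl
parse-outcome (parsing malformed) = inj₂ refl
parse-outcome (resetting _)      = inj₂ refl
parse-outcome (reading _ _ _)    = inj₂ refl
parse-outcome (applying _ _)     = inj₂ refl
parse-outcome (updating _ _ _ _ _ _) = inj₂ refl

sweeps-input : ∀ w → ∃[ b ] Sweeps parse (map input w) b
sweeps-input w with parse-outcome (proj₁ (sweep (transduce parse) (parsing atHeader) (map input w)))
... | inj₂ rejected = false , halts rejected
... | inj₁ accepted with parsed-tape (parses w atHeader accepted)
... | h , q , bs , eq with iterate-sweeps _ h q bs ≤-refl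
... | b , sweeps , _ =
  b , continues (subst (λ s → next parse s ≡ inj₁ reset) (sym accepted) refl)
                (subst (λ Y → Sweeps reset Y b) (sym eq) sweeps)

sweeps-deterministic : ∀ {p Y b b'} → Sweeps p Y b → Sweeps p Y b' → b ≡ b'
sweeps-deterministic (halts e)     (halts e')     = inj₂-injective (trans (sym e) e')
sweeps-deterministic (halts e)     (continues e' _) with trans (sym e) e'
... | ()
sweeps-deterministic (continues e _) (halts e')   with trans (sym e) e'
... | ()
sweeps-deterministic (continues e s) (continues e' s') with trans (sym e) e'
... | refl = sweeps-deterministic s s'

decide : List Bool → Bool
decide w = proj₁ (sweeps-input w)

parse-unary : ∀ {p p'} → parseCell p (input true) ≡ (parsing p , tally false) →
                         parseCell p (input false) ≡ (parsing p' , emptyEnd) →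
  ∀ k → Transduces (transduce parse) (parsing p) (map input (unary k)) (parsing p') (fieldCells (mkField 0 k false noMarks))
parse-unary loop end zero    = tr-∷ _ end tr-[]
parse-unary loop end (suc k) = tr-∷ _ loop (parse-unary loop end k)

parse-header : ∀ k →
  Transduces (transduce parse) (parsing atHeader) (map input (unary k)) (parsing atStart) (replicate (suc k) header)
parse-header zero    = tr-∷ _ refl tr-[]
parse-header (suc k) = tr-∷ _ refl (parse-header k)

parse-fieldA : ∀ k →
  Transduces (transduce parse) (parsing atBlock) (map input (unary k)) (parsing atFieldB) (fieldCells (mkField 0 k false noMarks))
parse-fieldA zero    = tr-∷ _ refl tr-[]
parse-fieldA (suc k) = tr-∷ _ refl (parse-unary refl refl k)

map-++₃ : ∀ {A B : Set} (f : A → B) xs ys zs → map f (xs ++ ys ++ zs) ≡ map f xs ++ map f ys ++ map f zs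
map-++₃ f xs ys zs = trans (map-++ f xs _) (cong (map f xs ++_) (map-++ f ys zs))

module Encoding (D : GameDFA) where
  open GameDFA D
  open Attractor D

  stateCode : Fin nQ → List Bool
  stateCode q = unary (toℕ (δ q false)) ++ unary (toℕ (δ q true)) ++ F∃ q ∷ F∀ q ∷ []

  stateBlock : Fin nQ → Block
  stateBlock q = parsedBlock (toℕ (δ q false)) (toℕ (δ q true)) (F∃ q) (F∀ q)

  blocks : List Block
  blocks = map stateBlock (allFin nQ)

  startField : Field
  startField = mkField 0 (toℕ q₀) false noMarks

  parse-state : ∀ q →
    Transduces (transduce parse) (parsing atBlock) (map input (stateCode q)) (parsing atBlock) (blockCells (stateBlock q))
  parse-state q =
    tr-≡-in (tr-++ (map input (unary (toℕ (δ q false)))) (parse-fieldA _)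
              (tr-++ (map input (unary (toℕ (δ q true)))) (parse-unary refl refl _) (tr-∷ _ refl (tr-∷ _ refl tr-[]))))
            (sym (map-++₃ input (unary (toℕ (δ q false))) (unary (toℕ (δ q true))) _))

  parse-states : ∀ qs → Transduces (transduce parse) (parsing atBlock) (map input (concatMap stateCode qs))
                                   (parsing atBlock) (blocksCells (map stateBlock qs))
  parse-states []       = tr-[]
  parse-states (q ∷ qs) = tr-≡-in (tr-++ (map input (stateCode q)) (parse-state q) (parse-states qs))
                                  (sym (map-++ input (stateCode q) (concatMap stateCode qs)))

  parse-encode :
    Transduces (transduce parse) (start parse) (map input (encode D)) (parsing atBlock) (tapeCells (suc nQ) startField blocks)
  parse-encode =
    tr-≡-in (tr-++ (map input (unary nQ)) (parse-header nQ)
              (tr-++ (map input (unary (toℕ q₀))) (parse-unary refl refl _) (parse-states (allFin nQ))))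
            (sym (map-++₃ input (unary nQ) (unary (toℕ q₀)) _))

  stateNode : Fin nQ → Node
  stateNode q = node (toℕ (δ q false)) (toℕ (δ q true)) (F∃ q) (F∀ q)

  lookupMarks-tabulate : ∀ {n} (X : Fin n → Marks) q → lookupMarks (tabulate X) (toℕ q) ≡ X q
  lookupMarks-tabulate X fzero    = refl
  lookupMarks-tabulate X (fsuc q) = lookupMarks-tabulate (λ x → X (fsuc x)) q

  lookupMarks-allFin : ∀ (X : Fin nQ → Marks) q → lookupMarks (map X (allFin nQ)) (toℕ q) ≡ X q
  lookupMarks-allFin X q =
    trans (cong (λ ms → lookupMarks ms (toℕ q)) (map-tabulate (λ x → x) X)) (lookupMarks-tabulate X q)

  table : (Fin nQ → Marks) → List Marks
  table X = map X (allFin nQ)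

  nodes : List Node
  nodes = map stateNode (allFin nQ)

  marksStep-winMarks : ∀ j → marksStep nodes (table (winMarks j)) ≡ table (winMarks (suc j))
  marksStep-winMarks j = trans (zipWith-map (attractAt (table (winMarks j))) stateNode (winMarks j) (allFin nQ))
    (map-cong (λ q → cong₂ (λ x y → winMarks j q ∪ᴹ attract (F∃ q) (F∀ q) x y)
                           (lookupMarks-allFin (winMarks j) (δ q false)) (lookupMarks-allFin (winMarks j) (δ q true)))
              (allFin nQ))

  iter-winMarks : ∀ K → iter (marksStep nodes) K (table (winMarks 0)) ≡ table (winMarks K)
  iter-winMarks zero    = refl
  iter-winMarks (suc K) = trans (cong (marksStep nodes) (iter-winMarks K)) (marksStep-winMarks K)

  table-equal : ∀ {X Y : Fin nQ → Marks} → table X ≡ table Y → ∀ q → X q ≡ Y q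
  table-equal {X} {Y} e q =
    trans (sym (lookupMarks-allFin X q)) (trans (cong (λ ms → lookupMarks ms (toℕ q)) e) (lookupMarks-allFin Y q))

  winMarks-answer : ∀ {b} → FixpointAnswer nodes (table (winMarks 0)) (toℕ q₀) b →
    ∃[ K ] StableAt K × b ≡ win₀ (winMarks K q₀)
  winMarks-answer (K , answer , stable) =
    K , table-equal (trans (sym (marksStep-winMarks K)) (subst (Stable nodes) (iter-winMarks K) stable)) ,
    trans answer (trans (cong (λ ms → win₀ (lookupMarks ms (toℕ q₀))) (iter-winMarks K))
                        (cong win₀ (lookupMarks-allFin (winMarks K) q₀)))

  decide-encode : ∃[ K ] StableAt K × decide (encode D) ≡ win₀ (winMarks K q₀)
  decide-encode with iterate-sweeps _ (suc nQ) startField blocks ≤-refl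
  ... | b , sweeps , answer
    with winMarks-answer (fixpointAnswer-cong (sym (map-∘ (allFin nQ))) (sym (map-∘ (allFin nQ))) refl answer)
  ... | K , stable , b≡ = K , stable ,
        trans (sweeps-deterministic (proj₂ (sweeps-input (encode D))) (sweeps-continue parse-encode refl sweeps)) b≡

  decide⇔forcedWin : ∀ P → MidPositive P → decide (encode D) ≡ true ⇔ ForcedWin D P
  decide⇔forcedWin P midPositive =
    let K , stable , decided = decide-encode in
    ⇔-sym (forcedWin⇔ P midPositive K stable) ⇔-∘ mk⇔ (trans (sym decided)) (trans decided)

mainTheorem12 : (P : Policy) → MidPositive P →
    DecidableInPSPACE encode (λ D → ForcedWin D P)
mainTheorem12 P midPositive = machine , 2 , 1 , haltsWithinSpace ,
  λ D → Encoding.decide⇔forcedWin D P midPositive ⇔-∘ accepts⇔ (encode D)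
  where
  open Decides decide (λ w → proj₂ (sweeps-input w))
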